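{- Let $n\ge 5$ and let $R\in\mathcal{PC}_n$ be a $4$-block triangular perturbed consistent matrix. Let $A$ be a matrix monomially similar to $R$ of the form $$A=\begin{bmatrix} B & J_{4,n-4}\\ J_{n-4,4} & J_{n-4}\end{bmatrix},\qquad B=\begin{bmatrix}1&1&a_{13}&a_{14}\\ 1&1&1&a_{24}\\ \frac1{a_{13}}&1&1&1\\ \frac1{a_{14}}&\frac1{a_{24}}&1&1\end{bmatrix},$$ with $a_{13},a_{24}>0$ and $a_{14}\ge 1$. Then $\mathcal{C}(R)\subseteq\mathcal{E}(R)$ if and only if neither of the conditions (1) $1<a_{24}<a_{14}<a_{13}$, (2) $a_{24}<1<a_{13}<a_{14}$ holds.
   Context: $\mathcal{PC}_n$ denotes the set of $n$-by-$n$ reciprocal matrices, i.e. entrywise positive matrices $[a_{ij}]$ with $a_{ji}=1/a_{ij}$. $J_{p,q}$ is the $p$-by-$q$ all-ones matrix, $J_p=J_{p,p}$. A monomial matrix is a product of a permutation matrix and a positive diagonal matrix; $A$ is monomially similar to $R$ if $A=SRS^{ -1}$ for some monomial $S$. A matrix $R\in\mathcal{PC}_n$, $n\ge5$, is a $4$-block triangular perturbed consistent matrix if it is monomially similar to a matrix of the displayed form $A$ for some positive $a_{13},a_{14},a_{24}$. A positive vector $w$ is efficient for $M=[m_{ij}]\in\mathcal{PC}_n$ if for every positive vector $v$, $|m_{ij}-v_i/v_j|\le|m_{ij}-w_i/w_j|$ for all $i,j$ implies $v$ is a positive multiple of $w$; $\mathcal{E}(M)$ is the set of efficient vectors. $\mathcal{C}(M)$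 is the set of nonzero nonnegative linear combinations of the columns of $M$. -}

module Defs where

open import Data.Nat using (ℕ; zero; suc)
open import Data.Fin using (Fin; toℕ)
import Data.Fin as F
open import Data.Fin.Permutation using (Permutation′; _⟨$⟩ʳ_)
open import Data.Product using (Σ; ∃; _×_; _,_)
open import Data.Sum using (_⊎_)
open import Relation.Binary.PropositionalEquality using (_≡_; _≢_)
open import Relation.Nullary using (¬_)

record RealField : Set₁ where
  infixl 6 _+_ _-_
  infixl 7 _*_
  infix 4 _<_
  field
    Carrier : Set
    0# 1# : Carrier
    _+_ _*_ : Carrier → Carrier → Carrier
    -_ : Carrier → Carrier
    _⁻¹ : Carrier → Carrier
    _<_ : Carrier → Carrier → Set
    abs : Carrier → Carrier
    +-assoc : ∀ x y z → (x + y) + z ≡ x + (y + z)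
    +-comm : ∀ x y → x + y ≡ y + x
    +-identityˡ : ∀ x → 0# + x ≡ x
    -‿inverseˡ : ∀ x → (- x) + x ≡ 0#
    *-assoc : ∀ x y z → (x * y) * z ≡ x * (y * z)
    *-comm : ∀ x y → x * y ≡ y * x
    *-identityˡ : ∀ x → 1# * x ≡ x
    distribˡ : ∀ x y z → x * (y + z) ≡ x * y + x * z
    0≢1 : 0# ≢ 1#
    ⁻¹-inverse : ∀ x → x ≢ 0# → x * (x ⁻¹) ≡ 1#
    0⁻¹ : 0# ⁻¹ ≡ 0#
    <-irrefl : ∀ x → ¬ (x < x)
    <-trans : ∀ x y z → x < y → y < z → x < z
    <-trichotomy : ∀ x y → x < y ⊎ (x ≡ y ⊎ y < x)
    +-mono-< : ∀ x y z → x < y → x + z < y + z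
    *-pos : ∀ x y → 0# < x → 0# < y → 0# < x * y
    abs-nonneg : ∀ x → ¬ (x < 0#) → abs x ≡ x
    abs-neg : ∀ x → x < 0# → abs x ≡ - x
  _-_ : Carrier → Carrier → Carrier
  x - y = x + (- y)
  _/_ : Carrier → Carrier → Carrier
  x / y = x * (y ⁻¹)
  infix 4 _≤_
  _≤_ : Carrier → Carrier → Set
  x ≤ y = x < y ⊎ x ≡ y
  field
    complete : (P : Carrier → Set) → (∃ λ x → P x) → (∃ λ b → ∀ x → P x → x ≤ b) →
               ∃ λ s → (∀ x → P x → x ≤ s) × (∀ b → (∀ x → P x → x ≤ b) → s ≤ b)

module Theory (ℝ : RealField) where
  open RealField ℝ

  Matrix : ℕ → Set
  Matrix n = Fin n → Fin n → Carrier

  Vector : ℕ → Set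
  Vector n = Fin n → Carrier

  Positive : ∀ {n} → Vector n → Set
  Positive w = ∀ i → 0# < w i

  Reciprocal : ∀ {n} → Matrix n → Set
  Reciprocal M = (∀ i j → 0# < M i j) × (∀ i j → M j i ≡ 1# / M i j)

  -- A = S R S⁻¹ with S = D P monomial (P permutation, D positive diagonal):
  -- A i j = d i * R (π i) (π j) / d j
  MonomiallySimilar : ∀ {n} → Matrix n → Matrix n → Set
  MonomiallySimilar {n} A R =
    Σ (Permutation′ n) λ π → Σ (Vector n) λ d → Positive d ×
      (∀ i j → A i j ≡ (d i * R (π ⟨$⟩ʳ i) (π ⟨$⟩ʳ j)) / d j)

  Efficient : ∀ {n} → Matrix n → Vector n → Set
  Efficient {n} M w = Positive w ×
    ((v : Vector n) → Positive v →
      (∀ i j → abs (M i j - v i / v j) ≤ abs (M i j - w i / w j)) →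
      ∃ λ c → 0# < c × (∀ i → v i ≡ c * w i))

  sumF : ∀ n → (Fin n → Carrier) → Carrier
  sumF zero f = 0#
  sumF (suc n) f = f F.zero + sumF n (λ j → f (F.suc j))

  InCone : ∀ {n} → Matrix n → Vector n → Set
  InCone {n} M w = Σ (Vector n) λ c → (∀ j → 0# ≤ c j) × (∃ λ j → c j ≢ 0#) ×
    (∀ i → w i ≡ sumF n (λ j → c j * M i j))

  ConeInEfficient : ∀ {n} → Matrix n → Set
  ConeInEfficient {n} M = (w : Vector n) → InCone M w → Efficient M w

  -- entries of B (0-based indices); every entry outside the leading 4×4 block is 1
  entryB : Carrier → Carrier → Carrier → ℕ → ℕ → Carrier
  entryB a13 a14 a24 0 2 = a13
  entryB a13 a14 a24 0 3 = a14
  entryB a13 a14 a24 1 3 = a24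
  entryB a13 a14 a24 2 0 = 1# / a13
  entryB a13 a14 a24 3 0 = 1# / a14
  entryB a13 a14 a24 3 1 = 1# / a24
  entryB a13 a14 a24 _ _ = 1#

  blockA : ∀ n → Carrier → Carrier → Carrier → Matrix n
  blockA n a13 a14 a24 i j = entryB a13 a14 a24 (toℕ i) (toℕ j)

{-# OPTIONS --safe #-}
module Submission where

-- Write α, β, γ for a13, a14, a24. Monomial similarity preserves both the column cone and
-- efficiency, so it suffices to study A. Call i → j an edge of a positive w when a_ij w_j ≤ w_i.
-- If v dominates w, the ratio v_i / w_i can only grow along an edge, so a closed walk of edges
-- through every index forces v to be proportional to w. Conversely, if a_kt w_t < w_k for every
-- k ≠ t, raising w_t a little yields a dominating vector that is not proportional to w.
-- For w = A c with c ≥ 0 the entries of w take five values P₀, …, P₄ (rows 4, 5, … coincide),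
-- and every P_i - a_ij P_j is a linear form in c whose coefficients are products of differences
-- of 1, α, β, γ. Apart from the two exceptional orderings and the orderings 1 < α < β < γ and
-- α < 1 < γ < β, the signs of these coefficients alone give a closed walk through all five
-- values. In those two orderings a positive combination of three of the forms has nonpositive
-- coefficients, so one of three candidate edges into vertex 0, respectively 1, exists. In the
-- exceptional orderings an explicit c makes vertex 3, respectively 2, a sink.

open import Defs
open import Data.Nat as ℕ using (ℕ; zero; suc; _∸_)
open import Data.Fin as Fin using (Fin)
open import Data.Fin.Patterns using (0F; 1F; 2F; 3F; 4F)
open import Data.Fin.Properties using (all?; toℕ-↑ˡ)
open import Data.Fin.Permutation using (Permutation′; _⟨$⟩ʳ_; _⟨$⟩ˡ_; inverseˡ; inverseʳ; flip)
open import Data.List using (List; _∷_; [])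
open import Data.List.Relation.Unary.Any using (here; there)
open import Data.Maybe using (just; nothing)
open import Data.Product using (∃-syntax; _×_; _,_; proj₁; proj₂)
open import Data.Product.Properties using (≡-dec)
open import Data.Sum using (_⊎_; inj₁; inj₂; [_,_]′)
open import Data.Vec.Functional using (updateAt)
open import Data.Vec.Functional.Properties using (updateAt-updates; updateAt-minimal)
open import Function using (_∘_; _⇔_; mk⇔)
open import Function.Construct.Composition using (_⇔-∘_)
open import Relation.Nullary using (¬_; ¬?; yes; no; contradiction)
open import Relation.Nullary.Decidable using (True; toWitness)
open import Relation.Unary using (Decidable)
open import Relation.Binary.Bundles using (StrictTotalOrder)
open import Relation.Binary.Definitions using (WeaklyDecidable; Trichotomous; tri<; tri≈; tri>)
open import Relation.Binary.PropositionalEquality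
  using (_≡_; _≢_; refl; sym; trans; cong; cong₂; subst; subst₂; module ≡-Reasoning)
import Relation.Binary.PropositionalEquality as Eq
open import Relation.Binary.Construct.Closure.ReflexiveTransitive as Star using (Star; ε; _◅_; _◅◅_)
import Relation.Binary.Properties.StrictTotalOrder as StrictTotalOrderProperties
open import Algebra.Bundles using (CommutativeRing; RawRing; Ring)
open import Algebra.Solver.Ring.AlmostCommutativeRing using (fromCommutativeRing; _-Raw-AlmostCommutative⟶_)
import Algebra.Solver.Ring
import Algebra.Properties.CommutativeMonoid.Sum
import Algebra.Properties.Semiring.Sum

module IntegerCoefficientSolver {c ℓ} (R : CommutativeRing c ℓ) where
  open CommutativeRing R hiding (zero) renaming (refl to ≈-refl; sym to ≈-sym; trans to ≈-trans)
  open import Algebra.Properties.Semiring.Mult.TCOptimised semiring using (×-homo-+; ×1-homo-*) renaming (_×_ to _×ᴿ_)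
  open import Algebra.Properties.RingWithoutOne (Ring.ringWithoutOne ring) using (x[y-z]≈xy-xz; [y-z]x≈yx-zx)
  open import Algebra.Properties.AbelianGroup +-abelianGroup using (ε⁻¹≈ε; ⁻¹-∙-comm; ⁻¹-anti-homo‿-)
  open import Algebra.Properties.CommutativeSemigroup +-commutativeSemigroup using (interchange)
  open import Relation.Binary.Reasoning.Setoid setoid

  -- An integer is a pair (a , b) standing for a - b. The operations normalise (one component
  -- is 0), so the solver's normal forms are syntactically unique, and ⟦_⟧ is split on b so that
  -- (0 , 0) and (1 , 0) denote 0# and 1# definitionally (in this _×ᴿ_, 1 ×ᴿ x is x).
  ℤ₂ : Set
  ℤ₂ = ℕ × ℕ

  normalise : ℕ → ℕ → ℤ₂
  normalise a b = a ∸ b , b ∸ a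

  coefficients : RawRing _ _
  coefficients = record
    { Carrier = ℤ₂
    ; _≈_ = _≡_
    ; _+_ = λ (a , b) (c , d) → normalise (a ℕ.+ c) (b ℕ.+ d)
    ; _*_ = λ (a , b) (c , d) → normalise (a ℕ.* c ℕ.+ b ℕ.* d) (a ℕ.* d ℕ.+ b ℕ.* c)
    ; -_ = λ (a , b) → b , a
    ; 0# = 0 , 0
    ; 1# = 1 , 0
    }

  ⟦_⟧ : ℤ₂ → Carrier
  ⟦ a , zero ⟧ = a ×ᴿ 1#
  ⟦ a , suc b ⟧ = a ×ᴿ 1# - suc b ×ᴿ 1#

  ⟦⟧≈difference : ∀ a b → ⟦ a , b ⟧ ≈ a ×ᴿ 1# - b ×ᴿ 1#
  ⟦⟧≈difference a zero = ≈-sym (≈-trans (+-congˡ ε⁻¹≈ε) (+-identityʳ _))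
  ⟦⟧≈difference a (suc b) = ≈-refl

  [p+q]-[r+s]≈[p-r]+[q-s] : ∀ p q r s → (p + q) - (r + s) ≈ (p - r) + (q - s)
  [p+q]-[r+s]≈[p-r]+[q-s] p q r s = ≈-trans (+-congˡ (≈-sym (⁻¹-∙-comm r s))) (interchange p q (- r) (- s))

  [p-q]-[r-s]≈[p+s]-[q+r] : ∀ p q r s → (p - q) - (r - s) ≈ (p + s) - (q + r)
  [p-q]-[r-s]≈[p+s]-[q+r] p q r s = begin
    (p - q) - (r - s)     ≈⟨ +-congˡ (⁻¹-anti-homo‿- r s) ⟩
    (p - q) + (s - r)     ≈⟨ interchange p (- q) s (- r) ⟩
    (p + s) + (- q - r)   ≈⟨ +-congˡ (⁻¹-∙-comm q r) ⟩
    (p + s) - (q + r)     ∎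

  normalise-correct : ∀ a b → ⟦ normalise a b ⟧ ≈ a ×ᴿ 1# - b ×ᴿ 1#
  normalise-correct zero zero = ⟦⟧≈difference 0 0
  normalise-correct zero (suc b) = ≈-refl
  normalise-correct (suc a) zero = ⟦⟧≈difference (suc a) zero
  normalise-correct (suc a) (suc b) = begin
    ⟦ normalise a b ⟧                ≈⟨ normalise-correct a b ⟩
    a ×ᴿ 1# - b ×ᴿ 1#                ≈⟨ +-identityˡ _ ⟨
    0# + (a ×ᴿ 1# - b ×ᴿ 1#)         ≈⟨ +-congʳ (-‿inverseʳ 1#) ⟨
    (1# - 1#) + (a ×ᴿ 1# - b ×ᴿ 1#)  ≈⟨ [p+q]-[r+s]≈[p-r]+[q-s] 1# _ 1# _ ⟨
    (1# + a ×ᴿ 1#) - (1# + b ×ᴿ 1#)  ≈⟨ +-cong (×-homo-+ 1# 1 a) (-‿cong (×-homo-+ 1# 1 b)) ⟨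
    suc a ×ᴿ 1# - suc b ×ᴿ 1#        ∎

  homomorphism : coefficients -Raw-AlmostCommutative⟶ fromCommutativeRing R
  homomorphism = record
    { ⟦_⟧ = ⟦_⟧
    ; +-homo = λ (a , b) (c , d) → begin
        ⟦ normalise (a ℕ.+ c) (b ℕ.+ d) ⟧            ≈⟨ normalise-correct (a ℕ.+ c) (b ℕ.+ d) ⟩
        (a ℕ.+ c) ×ᴿ 1# - (b ℕ.+ d) ×ᴿ 1#            ≈⟨ +-cong (×-homo-+ 1# a c) (-‿cong (×-homo-+ 1# b d)) ⟩
        (a ×ᴿ 1# + c ×ᴿ 1#) - (b ×ᴿ 1# + d ×ᴿ 1#)    ≈⟨ [p+q]-[r+s]≈[p-r]+[q-s] _ _ _ _ ⟩
        (a ×ᴿ 1# - b ×ᴿ 1#) + (c ×ᴿ 1# - d ×ᴿ 1#)    ≈⟨ +-cong (⟦⟧≈difference a b) (⟦⟧≈difference c d) ⟨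
        ⟦ a , b ⟧ + ⟦ c , d ⟧                         ∎
    ; *-homo = λ (a , b) (c , d) →
        let A = a ×ᴿ 1# ; B = b ×ᴿ 1# ; C = c ×ᴿ 1# ; D = d ×ᴿ 1# in begin
        ⟦ normalise (a ℕ.* c ℕ.+ b ℕ.* d) (a ℕ.* d ℕ.+ b ℕ.* c) ⟧
          ≈⟨ normalise-correct (a ℕ.* c ℕ.+ b ℕ.* d) (a ℕ.* d ℕ.+ b ℕ.* c) ⟩
        (a ℕ.* c ℕ.+ b ℕ.* d) ×ᴿ 1# - (a ℕ.* d ℕ.+ b ℕ.* c) ×ᴿ 1#
          ≈⟨ +-cong (≈-trans (×-homo-+ 1# (a ℕ.* c) (b ℕ.* d)) (+-cong (×1-homo-* a c) (×1-homo-* b d)))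
                    (-‿cong (≈-trans (×-homo-+ 1# (a ℕ.* d) (b ℕ.* c)) (+-cong (×1-homo-* a d) (×1-homo-* b c)))) ⟩
        (A * C + B * D) - (A * D + B * C)     ≈⟨ [p-q]-[r-s]≈[p+s]-[q+r] _ _ _ _ ⟨
        (A * C - A * D) - (B * C - B * D)     ≈⟨ +-cong (x[y-z]≈xy-xz A C D) (-‿cong (x[y-z]≈xy-xz B C D)) ⟨
        A * (C - D) - B * (C - D)             ≈⟨ [y-z]x≈yx-zx (C - D) A B ⟨
        (A - B) * (C - D)                     ≈⟨ *-cong (⟦⟧≈difference a b) (⟦⟧≈difference c d) ⟨
        ⟦ a , b ⟧ * ⟦ c , d ⟧                 ∎
    ; -‿homo = λ (a , b) → begin
        ⟦ b , a ⟧               ≈⟨ ⟦⟧≈difference b a ⟩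
        b ×ᴿ 1# - a ×ᴿ 1#       ≈⟨ ⁻¹-anti-homo‿- _ _ ⟨
        - (a ×ᴿ 1# - b ×ᴿ 1#)   ≈⟨ -‿cong (⟦⟧≈difference a b) ⟨
        - ⟦ a , b ⟧             ∎
    ; 0-homo = ≈-refl
    ; 1-homo = ≈-refl
    }

  _≟-coefficient_ : WeaklyDecidable (λ p q → ⟦ p ⟧ ≈ ⟦ q ⟧)
  p ≟-coefficient q with ≡-dec ℕ._≟_ ℕ._≟_ p q
  ... | yes p≡q = just (reflexive (cong ⟦_⟧ p≡q))
  ... | no _ = nothing

  open Algebra.Solver.Ring coefficients (fromCommutativeRing R) homomorphism _≟-coefficient_ public
    using (Polynomial; solve; _:=_; _:+_; _:*_; _:-_; :-_; con)

  :0 :1 : ∀ {n} → Polynomial n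
  :0 = con (0 , 0)
  :1 = con (1 , 0)

  expressions : ℕ → RawRing _ _
  expressions n = record
    { Carrier = Polynomial n ; _≈_ = _≡_
    ; _+_ = _:+_ ; _*_ = _:*_ ; -_ = :-_ ; 0# = :0 ; 1# = :1 }

-- For a cone vector A c write X₀ = c₀ / (α β), X₁ = c₁ / γ, x₂ = c₂, x₃ = c₃ and let T be the sum
-- of the remaining cⱼ. The entries of A c are then row 0, …, row 3 in rows 0 to 3 and row 4 in
-- every later row: a₀, a₁, b₂, b₃ are the columns 0 to 3 of A scaled by α β, γ, 1, 1. Stating this
-- over an arbitrary raw ring makes the same definitions serve as ring-solver syntax.
module Rows {c ℓ} (R : RawRing c ℓ) (α β γ X₀ X₁ x₂ x₃ T : RawRing.Carrier R) where
  open RawRing R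

  a₀ a₁ b₂ b₃ : Fin 5 → Carrier
  a₀ 0F = α * β
  a₀ 1F = α * β
  a₀ 2F = β
  a₀ 3F = α
  a₀ 4F = α * β
  a₁ 0F = γ
  a₁ 1F = γ
  a₁ 2F = γ
  a₁ 3F = 1#
  a₁ 4F = γ
  b₂ 0F = α
  b₂ 1F = 1#
  b₂ 2F = 1#
  b₂ 3F = 1#
  b₂ 4F = 1#
  b₃ 0F = β
  b₃ 1F = γ
  b₃ 2F = 1#
  b₃ 3F = 1#
  b₃ 4F = 1#

  row : Fin 5 → Carrier
  row i = X₀ * a₀ i + X₁ * a₁ i + x₂ * b₂ i + x₃ * b₃ i + T

  lin : Carrier → Carrier → Carrier → Carrier → Carrier → Carrier
  lin c₀ c₁ c₂ c₃ c₄ = c₀ * X₀ + c₁ * X₁ + c₂ * x₂ + c₃ * x₃ + c₄ * T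

-- Cone vectors making vertex 3 (for 1 < γ < β < α), respectively vertex 2 (for γ < 1 < α < β),
-- a strict sink: the three sink inequalities that are not automatic reduce to
-- 3 < α + 2 < 2α + 1 < 3α, respectively 3γ < 2γ + β < γ + 2β < 3β.
module SinkWitnesses {c ℓ} (R : RawRing c ℓ) (α β γ : RawRing.Carrier R) where
  open RawRing R

  infixl 6 _-_
  _-_ : Carrier → Carrier → Carrier
  x - y = x + - y

  two three : Carrier
  two = 1# + 1#
  three = 1# + 1# + 1#

  X₀³ X₁³ x₂³ X₀² X₁² x₃² : Carrier
  X₀³ = three * (γ - 1#)
  X₁³ = (α - β) * (α + two)
  x₂³ = (β - γ) * (two * α + 1#)
  X₀² = three * γ * (1# - γ)
  X₁² = (β - α) * (two * γ + β)
  x₃² = γ * (α - 1#) * (γ + two * β)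

  module Sink₃ = Rows R α β γ X₀³ X₁³ x₂³ 0# 0#
  module Sink₂ = Rows R α β γ X₀² X₁² 0# x₃² 0#

module Proof (ℝ : RealField) where
  open RealField ℝ
  open Theory ℝ
  open ≡-Reasoning

  -- Ordered field facts

  +-identityʳ : ∀ x → x + 0# ≡ x
  +-identityʳ x = trans (+-comm x 0#) (+-identityˡ x)

  *-identityʳ : ∀ x → x * 1# ≡ x
  *-identityʳ x = trans (*-comm x 1#) (*-identityˡ x)

  commutativeRing : CommutativeRing _ _
  commutativeRing = record
    { isCommutativeRing = record
      { isRing = record
        { +-isAbelianGroup = record
          { isGroup = record
            { isMonoid = record
              { isSemigroup = record
                { isMagma = record { isEquivalence = Eq.isEquivalence ; ∙-cong = cong₂ _+_ }
                ; assoc = +-assoc }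
              ; identity = +-identityˡ , +-identityʳ }
            ; inverse = -‿inverseˡ , λ x → trans (+-comm x (- x)) (-‿inverseˡ x)
            ; ⁻¹-cong = cong (-_) }
          ; comm = +-comm }
        ; *-cong = cong₂ _*_
        ; *-assoc = *-assoc
        ; *-identity = *-identityˡ , *-identityʳ
        ; distrib = distribˡ , λ x y z → trans (*-comm (y + z) x) (trans (distribˡ x y z) (cong₂ _+_ (*-comm x y) (*-comm x z)))
        }
      ; *-comm = *-comm
      }
    }

  open CommutativeRing commutativeRing using (zeroˡ; zeroʳ; -‿inverseʳ; +-abelianGroup)
  open import Algebra.Properties.AbelianGroup +-abelianGroup using () renaming (ε⁻¹≈ε to -0#≡0#)
  open IntegerCoefficientSolver commutativeRing using (solve; _:=_; _:+_; _:*_; _:-_; :-_; :0; :1; expressions)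

  inverse-unique : ∀ {x y} → x * y ≡ 1# → x ⁻¹ ≡ y
  inverse-unique {x} {y} xy≡1 = begin
    x ⁻¹                ≡⟨ *-identityʳ _ ⟨
    x ⁻¹ * 1#           ≡⟨ cong (x ⁻¹ *_) xy≡1 ⟨
    x ⁻¹ * (x * y)      ≡⟨ *-assoc _ _ _ ⟨
    x ⁻¹ * x * y        ≡⟨ cong (_* y) (trans (*-comm _ _) (⁻¹-inverse x x≢0)) ⟩
    1# * y              ≡⟨ *-identityˡ y ⟩
    y                   ∎
    where
    x≢0 : x ≢ 0#
    x≢0 x≡0 = 0≢1 (trans (sym (zeroˡ y)) (trans (cong (_* y) (sym x≡0)) xy≡1))

  ⁻¹-involutive : ∀ {x} → x ≢ 0# → x ⁻¹ ⁻¹ ≡ x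
  ⁻¹-involutive x≢0 = inverse-unique (trans (*-comm _ _) (⁻¹-inverse _ x≢0))

  ⁻¹-distrib-* : ∀ {x y} → x ≢ 0# → y ≢ 0# → (x * y) ⁻¹ ≡ x ⁻¹ * y ⁻¹
  ⁻¹-distrib-* {x} {y} x≢0 y≢0 = inverse-unique (begin
    x * y * (x ⁻¹ * y ⁻¹)         ≡⟨ solve 4 (λ x y x′ y′ → x :* y :* (x′ :* y′) := (x :* x′) :* (y :* y′)) refl x y (x ⁻¹) (y ⁻¹) ⟩
    (x * x ⁻¹) * (y * y ⁻¹)       ≡⟨ cong₂ _*_ (⁻¹-inverse x x≢0) (⁻¹-inverse y y≢0) ⟩
    1# * 1#                       ≡⟨ *-identityˡ 1# ⟩
    1#                            ∎)

  <-cmp : Trichotomous _≡_ _<_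
  <-cmp x y with <-trichotomy x y
  ... | inj₁ x<y = tri< x<y (λ { refl → <-irrefl x x<y }) (λ y<x → <-irrefl x (<-trans x y x x<y y<x))
  ... | inj₂ (inj₁ refl) = tri≈ (<-irrefl x) refl (<-irrefl x)
  ... | inj₂ (inj₂ y<x) = tri> (λ x<y → <-irrefl x (<-trans x y x x<y y<x)) (λ { refl → <-irrefl x y<x }) y<x

  <-strictTotalOrder : StrictTotalOrder _ _ _
  <-strictTotalOrder = record
    { isStrictTotalOrder = record
      { isStrictPartialOrder = record
        { isEquivalence = Eq.isEquivalence
        ; irrefl = λ { refl → <-irrefl _ }
        ; trans = <-trans _ _ _
        ; <-resp-≈ = (λ { refl x<y → x<y }) , (λ { refl x<y → x<y })
        }
      ; compare = <-cmp
      }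
    }

  open StrictTotalOrderProperties <-strictTotalOrder
    using () renaming (refl to ≤-refl; trans to ≤-trans; antisym to ≤-antisym; total to ≤-total)

  <-≤-trans : ∀ {x y z} → x < y → y ≤ z → x < z
  <-≤-trans x<y (inj₁ y<z) = <-trans _ _ _ x<y y<z
  <-≤-trans x<y (inj₂ refl) = x<y

  ≤-<-trans : ∀ {x y z} → x ≤ y → y < z → x < z
  ≤-<-trans (inj₁ x<y) y<z = <-trans _ _ _ x<y y<z
  ≤-<-trans (inj₂ refl) y<z = y<z

  ≤⇒≯ : ∀ {x y} → x ≤ y → ¬ y < x
  ≤⇒≯ x≤y y<x = <-irrefl _ (≤-<-trans x≤y y<x)

  <⇒≢ : ∀ {x y} → x < y → x ≢ y
  <⇒≢ x<y refl = <-irrefl _ x<y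

  >0⇒≢0 : ∀ {x} → 0# < x → x ≢ 0#
  >0⇒≢0 0<x x≡0 = <⇒≢ 0<x (sym x≡0)

  open-trisection : ∀ a b x → x ≤ a ⊎ (a < x × x < b) ⊎ b ≤ x
  open-trisection a b x with <-cmp x a | <-cmp x b
  ... | tri< x<a _ _ | _ = inj₁ (inj₁ x<a)
  ... | tri≈ _ x≡a _ | _ = inj₁ (inj₂ x≡a)
  ... | tri> _ _ a<x | tri< x<b _ _ = inj₂ (inj₁ (a<x , x<b))
  ... | tri> _ _ _ | tri≈ _ x≡b _ = inj₂ (inj₂ (inj₂ (sym x≡b)))
  ... | tri> _ _ _ | tri> _ _ b<x = inj₂ (inj₂ (inj₁ b<x))

  closed-trisection : ∀ a b x → x < a ⊎ (a ≤ x × x ≤ b) ⊎ b < x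
  closed-trisection a b x with <-cmp x a | <-cmp x b
  ... | tri< x<a _ _ | _ = inj₁ x<a
  ... | tri≈ _ x≡a _ | tri< x<b _ _ = inj₂ (inj₁ (inj₂ (sym x≡a) , inj₁ x<b))
  ... | tri≈ _ x≡a _ | tri≈ _ x≡b _ = inj₂ (inj₁ (inj₂ (sym x≡a) , inj₂ x≡b))
  ... | tri> _ _ a<x | tri< x<b _ _ = inj₂ (inj₁ (inj₁ a<x , inj₁ x<b))
  ... | tri> _ _ a<x | tri≈ _ x≡b _ = inj₂ (inj₁ (inj₁ a<x , inj₂ x≡b))
  ... | tri≈ _ _ _ | tri> _ _ b<x = inj₂ (inj₂ b<x)
  ... | tri> _ _ _ | tri> _ _ b<x = inj₂ (inj₂ b<x)

  +-monoˡ-< : ∀ z {x y} → x < y → x + z < y + z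
  +-monoˡ-< z = +-mono-< _ _ z

  +-monoʳ-< : ∀ z {x y} → x < y → z + x < z + y
  +-monoʳ-< z {x} {y} x<y = subst₂ _<_ (+-comm x z) (+-comm y z) (+-mono-< x y z x<y)

  +-monoˡ-≤ : ∀ z {x y} → x ≤ y → x + z ≤ y + z
  +-monoˡ-≤ z (inj₁ x<y) = inj₁ (+-monoˡ-< z x<y)
  +-monoˡ-≤ z (inj₂ refl) = ≤-refl

  +-mono-≤ : ∀ {x y u v} → x ≤ y → u ≤ v → x + u ≤ y + v
  +-mono-≤ {y = y} x≤y (inj₁ u<v) = ≤-trans (+-monoˡ-≤ _ x≤y) (inj₁ (+-monoʳ-< y u<v))
  +-mono-≤ x≤y (inj₂ refl) = +-monoˡ-≤ _ x≤y

  +-mono-<-≤ : ∀ {x y u v} → x < y → u ≤ v → x + u < y + v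
  +-mono-<-≤ {y = y} x<y u≤v = <-≤-trans (+-monoˡ-< _ x<y) (subst₂ _≤_ (+-comm _ y) (+-comm _ y) (+-monoˡ-≤ y u≤v))

  +-nonneg : ∀ {x y} → 0# ≤ x → 0# ≤ y → 0# ≤ x + y
  +-nonneg 0≤x 0≤y = subst (_≤ _) (+-identityˡ 0#) (+-mono-≤ 0≤x 0≤y)

  +-nonpos : ∀ {x y} → x ≤ 0# → y ≤ 0# → x + y ≤ 0#
  +-nonpos x≤0 y≤0 = subst (_ ≤_) (+-identityˡ 0#) (+-mono-≤ x≤0 y≤0)

  +-pos-nonneg : ∀ {x y} → 0# < x → 0# ≤ y → 0# < x + y
  +-pos-nonneg 0<x 0≤y = subst (_< _) (+-identityˡ 0#) (+-mono-<-≤ 0<x 0≤y)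

  x<x+y : ∀ {x y} → 0# < y → x < x + y
  x<x+y {x} 0<y = subst (_< x + _) (+-identityʳ x) (+-monoʳ-< x 0<y)

  x-y+y≡x : ∀ x y → x - y + y ≡ x
  x-y+y≡x = solve 2 (λ x y → x :- y :+ y := x) refl

  x≤y⇒0≤y-x : ∀ {x y} → x ≤ y → 0# ≤ y - x
  x≤y⇒0≤y-x {x} x≤y = subst (_≤ _) (-‿inverseʳ x) (+-monoˡ-≤ (- x) x≤y)

  x<y⇒0<y-x : ∀ {x y} → x < y → 0# < y - x
  x<y⇒0<y-x {x} x<y = subst (_< _) (-‿inverseʳ x) (+-monoˡ-< (- x) x<y)

  x≤y⇒x-y≤0 : ∀ {x y} → x ≤ y → x - y ≤ 0#
  x≤y⇒x-y≤0 {y = y} x≤y = subst (_ ≤_) (-‿inverseʳ y) (+-monoˡ-≤ (- y) x≤y)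

  0≤y-x⇒x≤y : ∀ {x y} → 0# ≤ y - x → x ≤ y
  0≤y-x⇒x≤y {x} {y} 0≤y-x = subst₂ _≤_ (+-identityˡ x) (x-y+y≡x y x) (+-monoˡ-≤ x 0≤y-x)

  0<y-x⇒x<y : ∀ {x y} → 0# < y - x → x < y
  0<y-x⇒x<y {x} {y} 0<y-x = subst₂ _<_ (+-identityˡ x) (x-y+y≡x y x) (+-monoˡ-< x 0<y-x)

  x-y≤0⇒x≤y : ∀ {x y} → x - y ≤ 0# → x ≤ y
  x-y≤0⇒x≤y {x} {y} x-y≤0 = subst₂ _≤_ (x-y+y≡x x y) (+-identityˡ y) (+-monoˡ-≤ y x-y≤0)

  x-z≤y-z⇒x≤y : ∀ {x y z} → x - z ≤ y - z → x ≤ y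
  x-z≤y-z⇒x≤y {x} {y} {z} le = subst₂ _≤_ (x-y+y≡x x z) (x-y+y≡x y z) (+-monoˡ-≤ z le)

  x≤y⇒z-y≤z-x : ∀ {x y z} → x ≤ y → z - y ≤ z - x
  x≤y⇒z-y≤z-x {x} {y} {z} x≤y =
    0≤y-x⇒x≤y (subst (0# ≤_) (solve 3 (λ x y z → y :- x := (z :- x) :- (z :- y)) refl x y z) (x≤y⇒0≤y-x x≤y))

  z-x≤z-y⇒y≤x : ∀ {x y z} → z - x ≤ z - y → y ≤ x
  z-x≤z-y⇒y≤x {x} {y} {z} le =
    x-y≤0⇒x≤y (subst (_≤ 0#) (solve 3 (λ x y z → (z :- x) :- (z :- y) := y :- x) refl x y z) (x≤y⇒x-y≤0 le))

  -[x-y]≡y-x : ∀ x y → - (x - y) ≡ y - x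
  -[x-y]≡y-x = solve 2 (λ x y → :- (x :- y) := y :- x) refl

  *-nonneg : ∀ {x y} → 0# ≤ x → 0# ≤ y → 0# ≤ x * y
  *-nonneg (inj₁ 0<x) (inj₁ 0<y) = inj₁ (*-pos _ _ 0<x 0<y)
  *-nonneg {y = y} (inj₂ refl) _ = inj₂ (sym (zeroˡ y))
  *-nonneg {x} (inj₁ _) (inj₂ refl) = inj₂ (sym (zeroʳ x))

  *-monoˡ-< : ∀ {c x y} → 0# < c → x < y → c * x < c * y
  *-monoˡ-< {c} {x} {y} 0<c x<y =
    0<y-x⇒x<y (subst (0# <_) (solve 3 (λ c x y → c :* (y :- x) := c :* y :- c :* x) refl c x y) (*-pos _ _ 0<c (x<y⇒0<y-x x<y)))

  *-monoʳ-< : ∀ {c x y} → 0# < c → x < y → x * c < y * c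
  *-monoʳ-< {c} {x} {y} 0<c x<y = subst₂ _<_ (*-comm c x) (*-comm c y) (*-monoˡ-< 0<c x<y)

  *-monoˡ-≤ : ∀ {c x y} → 0# < c → x ≤ y → c * x ≤ c * y
  *-monoˡ-≤ 0<c (inj₁ x<y) = inj₁ (*-monoˡ-< 0<c x<y)
  *-monoˡ-≤ 0<c (inj₂ refl) = ≤-refl

  *-monoʳ-≤ : ∀ {c x y} → 0# < c → x ≤ y → x * c ≤ y * c
  *-monoʳ-≤ {c} {x} {y} 0<c x≤y = subst₂ _≤_ (*-comm c x) (*-comm c y) (*-monoˡ-≤ 0<c x≤y)

  *-monoˡ-≤-nonneg : ∀ {c x y} → 0# ≤ c → x ≤ y → c * x ≤ c * y
  *-monoˡ-≤-nonneg (inj₁ 0<c) x≤y = *-monoˡ-≤ 0<c x≤y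
  *-monoˡ-≤-nonneg {x = x} {y} (inj₂ refl) _ = inj₂ (trans (zeroˡ x) (sym (zeroˡ y)))

  *-nonpos-nonneg : ∀ {x y} → x ≤ 0# → 0# ≤ y → x * y ≤ 0#
  *-nonpos-nonneg {x} {y} x≤0 0≤y = subst₂ _≤_ (*-comm y x) (zeroʳ y) (*-monoˡ-≤-nonneg 0≤y x≤0)

  *-nonneg-nonpos : ∀ {x y} → 0# ≤ x → y ≤ 0# → x * y ≤ 0#
  *-nonneg-nonpos {x} {y} 0≤x y≤0 = subst (_≤ 0#) (*-comm y x) (*-nonpos-nonneg y≤0 0≤x)

  *-cancelˡ-≤ : ∀ {c x y} → 0# < c → c * x ≤ c * y → x ≤ y
  *-cancelˡ-≤ {c} {x} {y} 0<c cx≤cy with <-cmp x y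
  ... | tri< x<y _ _ = inj₁ x<y
  ... | tri≈ _ x≡y _ = inj₂ x≡y
  ... | tri> _ _ y<x = contradiction (*-monoˡ-< 0<c y<x) (≤⇒≯ cx≤cy)

  *-cancelʳ-≡ : ∀ {x y z} → 0# < z → x * z ≡ y * z → x ≡ y
  *-cancelʳ-≡ {x} {y} {z} 0<z xz≡yz = ≤-antisym (*-cancelˡ-≤ 0<z (inj₂ zx≡zy)) (*-cancelˡ-≤ 0<z (inj₂ (sym zx≡zy)))
    where
    zx≡zy : z * x ≡ z * y
    zx≡zy = trans (*-comm z x) (trans xz≡yz (*-comm y z))

  0<1 : 0# < 1#
  0<1 with <-cmp 0# 1#
  ... | tri< 0<1 _ _ = 0<1
  ... | tri≈ _ 0≡1 _ = contradiction 0≡1 0≢1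
  ... | tri> _ _ 1<0 = contradiction (*-pos _ _ 0<-1 0<-1) (λ 0<1 → <-irrefl _ (<-trans _ _ _ 1<0 (subst (0# <_) [-1][-1]≡1 0<1)))
    where
    0<-1 : 0# < 0# - 1#
    0<-1 = x<y⇒0<y-x 1<0
    [-1][-1]≡1 : (0# - 1#) * (0# - 1#) ≡ 1#
    [-1][-1]≡1 = solve 0 ((:0 :- :1) :* (:0 :- :1) := :1) refl

  0<two : 0# < 1# + 1#
  0<two = +-pos-nonneg 0<1 (inj₁ 0<1)

  0<three : 0# < 1# + 1# + 1#
  0<three = +-pos-nonneg 0<two (inj₁ 0<1)

  one-of-three-nonpos : ∀ {a b c x y z} → 0# < a → 0# < b → 0# < c → a * x + b * y + c * z ≤ 0# →
                        x ≤ 0# ⊎ y ≤ 0# ⊎ z ≤ 0#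
  one-of-three-nonpos {x = x} {y} {z} 0<a 0<b 0<c sum≤0 with <-cmp 0# x | <-cmp 0# y | <-cmp 0# z
  ... | tri< 0<x _ _ | tri< 0<y _ _ | tri< 0<z _ _ =
    contradiction (+-pos-nonneg (+-pos-nonneg (*-pos _ _ 0<a 0<x) (inj₁ (*-pos _ _ 0<b 0<y))) (inj₁ (*-pos _ _ 0<c 0<z))) (≤⇒≯ sum≤0)
  ... | tri≈ _ refl _ | _ | _ = inj₁ ≤-refl
  ... | tri> _ _ x<0 | _ | _ = inj₁ (inj₁ x<0)
  ... | tri< _ _ _ | tri≈ _ refl _ | _ = inj₂ (inj₁ ≤-refl)
  ... | tri< _ _ _ | tri> _ _ y<0 | _ = inj₂ (inj₁ (inj₁ y<0))
  ... | tri< _ _ _ | tri< _ _ _ | tri≈ _ refl _ = inj₂ (inj₂ ≤-refl)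
  ... | tri< _ _ _ | tri< _ _ _ | tri> _ _ z<0 = inj₂ (inj₂ (inj₁ z<0))

  strictly-between : ∀ {n} x (f : Fin n → Carrier) (S : Fin n → Set) → Decidable S →
                     (∀ k → S k → x < f k) → ∃[ u ] x < u × (∀ k → S k → u ≤ f k)
  strictly-between {zero} x f S S? x<f = x + 1# , x<x+y 0<1 , λ ()
  strictly-between {suc n} x f S S? x<f
    with strictly-between x (f ∘ Fin.suc) (S ∘ Fin.suc) (S? ∘ Fin.suc) (x<f ∘ Fin.suc) | S? Fin.zero
  ... | u , x<u , u≤f | no ¬S0 = u , x<u , λ { Fin.zero S0 → contradiction S0 ¬S0 ; (Fin.suc k) → u≤f k }
  ... | u , x<u , u≤f | yes S0 with ≤-total u (f Fin.zero)
  ...   | inj₁ u≤f0 = u , x<u , λ { Fin.zero _ → u≤f0 ; (Fin.suc k) → u≤f k }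
  ...   | inj₂ f0≤u = f Fin.zero , x<f Fin.zero S0 , λ { Fin.zero _ → ≤-refl ; (Fin.suc k) Sk → ≤-trans f0≤u (u≤f k Sk) }

  x*x⁻¹≡1 : ∀ {x} → 0# < x → x * x ⁻¹ ≡ 1#
  x*x⁻¹≡1 0<x = ⁻¹-inverse _ (>0⇒≢0 0<x)

  ⁻¹-pos : ∀ {x} → 0# < x → 0# < x ⁻¹
  ⁻¹-pos {x} 0<x with <-cmp 0# (x ⁻¹)
  ... | tri< 0<x⁻¹ _ _ = 0<x⁻¹
  ... | tri≈ _ 0≡x⁻¹ _ = contradiction (trans (sym (zeroʳ x)) (trans (cong (x *_) 0≡x⁻¹) (x*x⁻¹≡1 0<x))) 0≢1
  ... | tri> _ _ x⁻¹<0 = contradiction (subst (_< 0#) (x*x⁻¹≡1 0<x) (subst (_ <_) (zeroʳ x) (*-monoˡ-< 0<x x⁻¹<0))) (≤⇒≯ (inj₁ 0<1))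

  ⁻¹-antitone : ∀ {x y} → 0# < x → x < y → y ⁻¹ < x ⁻¹
  ⁻¹-antitone {x} {y} 0<x x<y = 0<y-x⇒x<y (subst (0# <_) difference
    (*-pos _ _ (x<y⇒0<y-x x<y) (*-pos _ _ (⁻¹-pos 0<x) (⁻¹-pos 0<y))))
    where
    0<y : 0# < y
    0<y = <-trans _ _ _ 0<x x<y
    difference : (y - x) * (x ⁻¹ * y ⁻¹) ≡ x ⁻¹ - y ⁻¹
    difference = begin
      (y - x) * (x ⁻¹ * y ⁻¹)
        ≡⟨ solve 4 (λ x y x′ y′ → (y :- x) :* (x′ :* y′) := x′ :* (y :* y′) :- y′ :* (x :* x′)) refl x y (x ⁻¹) (y ⁻¹) ⟩
      x ⁻¹ * (y * y ⁻¹) - y ⁻¹ * (x * x ⁻¹)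
        ≡⟨ cong₂ (λ a b → x ⁻¹ * a - y ⁻¹ * b) (x*x⁻¹≡1 0<y) (x*x⁻¹≡1 0<x) ⟩
      x ⁻¹ * 1# - y ⁻¹ * 1#
        ≡⟨ cong₂ _-_ (*-identityʳ _) (*-identityʳ _) ⟩
      x ⁻¹ - y ⁻¹ ∎

  -- _/_ has no fixity declaration in Defs, so x * y / z parses as x * (y / z).
  x*y*y⁻¹≡x : ∀ {y} → 0# < y → ∀ x → x * y * y ⁻¹ ≡ x
  x*y*y⁻¹≡x {y} 0<y x = trans (*-assoc x y (y ⁻¹)) (trans (cong (x *_) (x*x⁻¹≡1 0<y)) (*-identityʳ x))

  x*y⁻¹*y≡x : ∀ {y} → 0# < y → ∀ x → x * y ⁻¹ * y ≡ x
  x*y⁻¹*y≡x {y} 0<y x = trans (*-assoc x (y ⁻¹) y) (trans (cong (x *_) (trans (*-comm _ _) (x*x⁻¹≡1 0<y))) (*-identityʳ x))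

  x*y≤z⇒x≤z/y : ∀ {x y z} → 0# < y → x * y ≤ z → x ≤ z / y
  x*y≤z⇒x≤z/y {x} 0<y xy≤z = subst (_≤ _) (x*y*y⁻¹≡x 0<y x) (*-monoʳ-≤ (⁻¹-pos 0<y) xy≤z)

  z≤x*y⇒z/y≤x : ∀ {x y z} → 0# < y → z ≤ x * y → z / y ≤ x
  z≤x*y⇒z/y≤x {x} 0<y z≤xy = subst (_ ≤_) (x*y*y⁻¹≡x 0<y x) (*-monoʳ-≤ (⁻¹-pos 0<y) z≤xy)

  x*y<z⇒y<z/x : ∀ {x y z} → 0# < x → x * y < z → y < z / x
  x*y<z⇒y<z/x {x} {y} 0<x xy<z =
    subst (_< _) (trans (cong (_* x ⁻¹) (*-comm x y)) (x*y*y⁻¹≡x 0<x y)) (*-monoʳ-< (⁻¹-pos 0<x) xy<z)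

  y≤z/x⇒x*y≤z : ∀ {x y z} → 0# < x → y ≤ z / x → x * y ≤ z
  y≤z/x⇒x*y≤z {x} {y} {z} 0<x y≤z/x =
    subst (x * y ≤_) (trans (*-comm x (z / x)) (x*y⁻¹*y≡x 0<x z)) (*-monoˡ-≤ 0<x y≤z/x)

  x*y≤z⇒y/z≤1/x : ∀ {x y z} → 0# < x → 0# < z → x * y ≤ z → y / z ≤ 1# / x
  x*y≤z⇒y/z≤1/x {x} {y} {z} 0<x 0<z xy≤z = subst₂ _≤_
    (trans (solve 4 (λ x y x′ z′ → x :* y :* (x′ :* z′) := y :* z′ :* x :* x′) refl x y (x ⁻¹) (z ⁻¹)) (x*y*y⁻¹≡x 0<x (y / z)))
    (trans (solve 3 (λ z x′ z′ → z :* (x′ :* z′) := :1 :* x′ :* z :* z′) refl z (x ⁻¹) (z ⁻¹)) (x*y*y⁻¹≡x 0<z (1# / x)))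
    (*-monoʳ-≤ (*-pos _ _ (⁻¹-pos 0<x) (⁻¹-pos 0<z)) xy≤z)

  abs-of-nonneg : ∀ {x} → 0# ≤ x → abs x ≡ x
  abs-of-nonneg 0≤x = abs-nonneg _ (≤⇒≯ 0≤x)

  abs-of-nonpos : ∀ {x} → x ≤ 0# → abs x ≡ - x
  abs-of-nonpos (inj₁ x<0) = abs-neg _ x<0
  abs-of-nonpos (inj₂ refl) = trans (abs-of-nonneg ≤-refl) (sym -0#≡0#)

  abs-*-pos : ∀ {c} x → 0# < c → abs (c * x) ≡ c * abs x
  abs-*-pos {c} x 0<c with <-cmp x 0#
  ... | tri< x<0 _ _ = begin
    abs (c * x)   ≡⟨ abs-of-nonpos (inj₁ (subst (_ <_) (zeroʳ c) (*-monoˡ-< 0<c x<0))) ⟩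
    - (c * x)     ≡⟨ solve 2 (λ c x → :- (c :* x) := c :* (:- x)) refl c x ⟩
    c * (- x)     ≡⟨ cong (c *_) (abs-of-nonpos (inj₁ x<0)) ⟨
    c * abs x     ∎
  ... | tri≈ _ refl _ = begin
    abs (c * 0#)  ≡⟨ cong abs (zeroʳ c) ⟩
    abs 0#        ≡⟨ abs-of-nonneg ≤-refl ⟩
    0#            ≡⟨ zeroʳ c ⟨
    c * 0#        ≡⟨ cong (c *_) (abs-of-nonneg ≤-refl) ⟨
    c * abs 0#    ∎
  ... | tri> _ _ 0<x = trans (abs-of-nonneg (inj₁ (*-pos _ _ 0<c 0<x))) (cong (c *_) (sym (abs-of-nonneg (inj₁ 0<x))))

  closer-above⇒≤ : ∀ {m x y} → m ≤ y → abs (m - x) ≤ abs (m - y) → x ≤ y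
  closer-above⇒≤ {m} {x} {y} m≤y closer with <-cmp x y
  ... | tri< x<y _ _ = inj₁ x<y
  ... | tri≈ _ x≡y _ = inj₂ x≡y
  ... | tri> _ _ y<x = contradiction y<x (≤⇒≯ (x-z≤y-z⇒x≤y (subst₂ _≤_ (distance m≤x) (distance m≤y) closer)))
    where
    m≤x : m ≤ x
    m≤x = inj₁ (≤-<-trans m≤y y<x)
    distance : ∀ {z} → m ≤ z → abs (m - z) ≡ z - m
    distance m≤z = trans (abs-of-nonpos (x≤y⇒x-y≤0 m≤z)) (-[x-y]≡y-x _ _)

  closer-below⇒≥ : ∀ {m x y} → y ≤ m → abs (m - x) ≤ abs (m - y) → y ≤ x
  closer-below⇒≥ {m} {x} {y} y≤m closer with <-cmp x y
  ... | tri< x<y _ _ = contradiction x<y (≤⇒≯ (z-x≤z-y⇒y≤x (subst₂ _≤_ (distance x≤m) (distance y≤m) closer)))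
    where
    x≤m : x ≤ m
    x≤m = inj₁ (<-≤-trans x<y y≤m)
    distance : ∀ {z} → z ≤ m → abs (m - z) ≡ m - z
    distance z≤m = abs-of-nonneg (x≤y⇒0≤y-x z≤m)
  ... | tri≈ _ x≡y _ = inj₂ (sym x≡y)
  ... | tri> _ _ y<x = inj₁ y<x

  towards-below⇒closer : ∀ {m x x′} → x ≤ x′ → x′ ≤ m → abs (m - x′) ≤ abs (m - x)
  towards-below⇒closer x≤x′ x′≤m = subst₂ _≤_
    (sym (abs-of-nonneg (x≤y⇒0≤y-x x′≤m))) (sym (abs-of-nonneg (x≤y⇒0≤y-x (≤-trans x≤x′ x′≤m))))
    (x≤y⇒z-y≤z-x x≤x′)

  towards-above⇒closer : ∀ {m x x′} → m ≤ x′ → x′ ≤ x → abs (m - x′) ≤ abs (m - x)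
  towards-above⇒closer {m} m≤x′ x′≤x = subst₂ _≤_
    (sym (trans (abs-of-nonpos (x≤y⇒x-y≤0 m≤x′)) (-[x-y]≡y-x _ _)))
    (sym (trans (abs-of-nonpos (x≤y⇒x-y≤0 (≤-trans m≤x′ x′≤x))) (-[x-y]≡y-x _ _)))
    (+-monoˡ-≤ (- m) x′≤x)

  -- Efficient vectors

  Dominates : ∀ {n} → Matrix n → Vector n → Vector n → Set
  Dominates M v w = ∀ i j → abs (M i j - v i / v j) ≤ abs (M i j - w i / w j)

  module Dominated {n} {M : Matrix n} {v w : Vector n}
                   (v>0 : Positive v) (w>0 : Positive w) (v≽w : Dominates M v w) where

    ratio-step : ∀ i j → (v i / v j) * (v j / w i) ≡ v i / w i
    ratio-step i j = trans (solve 4 (λ a b b′ c′ → a :* b′ :* (b :* c′) := a :* c′ :* b :* b′) refl (v i) (v j) (v j ⁻¹) (w i ⁻¹))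
                           (x*y*y⁻¹≡x (v>0 j) (v i / w i))

    weight-step : ∀ i j → (w i / w j) * (v j / w i) ≡ v j / w j
    weight-step i j = trans (solve 4 (λ a a′ b′ c → a :* b′ :* (c :* a′) := c :* b′ :* a :* a′) refl (w i) (w i ⁻¹) (w j ⁻¹) (v j))
                            (x*y*y⁻¹≡x (w>0 i) (v j / w j))

    0<v/w : ∀ i j → 0# < v j / w i
    0<v/w i j = *-pos _ _ (v>0 j) (⁻¹-pos (w>0 i))

    ratio-mono : ∀ {i j} → M i j * w j ≤ w i → v i / w i ≤ v j / w j
    ratio-mono {i} {j} Mw≤w = subst₂ _≤_ (ratio-step i j) (weight-step i j)
      (*-monoʳ-≤ (0<v/w i j) (closer-above⇒≤ (x*y≤z⇒x≤z/y (w>0 j) Mw≤w) (v≽w i j)))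

    ratio-antitone : ∀ {i j} → w i ≤ M i j * w j → v j / w j ≤ v i / w i
    ratio-antitone {i} {j} w≤Mw = subst₂ _≤_ (weight-step i j) (ratio-step i j)
      (*-monoʳ-≤ (0<v/w i j) (closer-below⇒≥ (z≤x*y⇒z/y≤x (w>0 j) w≤Mw) (v≽w i j)))

    proportional : ∀ {c} → (∀ i → v i / w i ≡ c) → ∀ i → v i ≡ c * w i
    proportional {c} v/w≡c i = trans (sym (x*y⁻¹*y≡x (w>0 i) (v i))) (cong (_* w i) (v/w≡c i))

  module _ {n} {M : Matrix n} (M-reciprocal : Reciprocal M) {w : Vector n} (w>0 : Positive w) {t : Fin n} where
    private
      M>0 : ∀ i j → 0# < M i j
      M>0 = proj₁ M-reciprocal

    -- Raising w t to u moves every ratio w k / w t and w t / w l towards the corresponding entry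
    -- of M without passing it, so the raised vector dominates w.
    raising-inefficient : ∀ {u} → w t < u → (∀ k → k ≢ t → M k t * u ≤ w k) → ∀ {k₀} → k₀ ≢ t → ¬ Efficient M w
    raising-inefficient {u} wt<u Mu≤w {k₀} k₀≢t (_ , efficient) = <⇒≢ wt<u (sym u≡wt)
      where
      v : Vector n
      v = updateAt w t (λ _ → u)
      0<u : 0# < u
      0<u = <-trans _ _ _ (w>0 t) wt<u
      v>0 : Positive v
      v>0 k with k Fin.≟ t
      ... | yes refl rewrite updateAt-updates t {λ _ → u} w = 0<u
      ... | no k≢t rewrite updateAt-minimal k t {λ _ → u} w k≢t = w>0 k
      v≽w : Dominates M v w
      v≽w k l with k Fin.≟ t | l Fin.≟ t
      ... | yes refl | yes refl rewrite updateAt-updates t {λ _ → u} w =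
        inj₂ (cong (λ r → abs (M t t - r)) (trans (x*x⁻¹≡1 0<u) (sym (x*x⁻¹≡1 (w>0 t)))))
      ... | yes refl | no l≢t rewrite updateAt-updates t {λ _ → u} w | updateAt-minimal l t {λ _ → u} w l≢t =
        towards-below⇒closer (*-monoʳ-≤ (⁻¹-pos (w>0 l)) (inj₁ wt<u))
          (subst (u / w l ≤_) (sym (proj₂ M-reciprocal l t)) (x*y≤z⇒y/z≤1/x (M>0 l t) (w>0 l) (Mu≤w l l≢t)))
      ... | no k≢t | yes refl rewrite updateAt-updates t {λ _ → u} w | updateAt-minimal k t {λ _ → u} w k≢t =
        towards-above⇒closer (x*y≤z⇒x≤z/y 0<u (Mu≤w k k≢t)) (*-monoˡ-≤ (w>0 k) (inj₁ (⁻¹-antitone (w>0 t) wt<u)))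
      ... | no k≢t | no l≢t rewrite updateAt-minimal k t {λ _ → u} w k≢t | updateAt-minimal l t {λ _ → u} w l≢t = ≤-refl
      c : Carrier
      c = proj₁ (efficient v v>0 v≽w)
      v≡cw : ∀ k → v k ≡ c * w k
      v≡cw = proj₂ (proj₂ (efficient v v>0 v≽w))
      c≡1 : c ≡ 1#
      c≡1 = *-cancelʳ-≡ (w>0 k₀) (begin
        c * w k₀   ≡⟨ v≡cw k₀ ⟨
        v k₀       ≡⟨ updateAt-minimal k₀ t w k₀≢t ⟩
        w k₀       ≡⟨ *-identityˡ (w k₀) ⟨
        1# * w k₀  ∎)
      u≡wt : u ≡ w t
      u≡wt = begin
        u          ≡⟨ updateAt-updates t w ⟨
        v t        ≡⟨ v≡cw t ⟩
        c * w t    ≡⟨ cong (_* w t) c≡1 ⟩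
        1# * w t   ≡⟨ *-identityˡ (w t) ⟩
        w t        ∎

    sink-inefficient : (∀ k → k ≢ t → M k t * w t < w k) → ∀ {k₀} → k₀ ≢ t → ¬ Efficient M w
    sink-inefficient Mw<w with strictly-between (w t) (λ k → w k / M k t) (_≢ t) (λ k → ¬? (k Fin.≟ t))
                                                 (λ k k≢t → x*y<z⇒y<z/x (M>0 k t) (Mw<w k k≢t))
    ... | u , wt<u , u≤w/M = raising-inefficient wt<u (λ k k≢t → y≤z/x⇒x*y≤z (M>0 k t) (u≤w/M k k≢t))

  efficient-cong : ∀ {n} {M : Matrix n} {w w′} → (∀ i → w i ≡ w′ i) → Efficient M w → Efficient M w′
  efficient-cong {M = M} w≗w′ (w>0 , efficient) = (λ i → subst (0# <_) (w≗w′ i) (w>0 i)) , λ v v>0 v≽w′ →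
    let c , 0<c , v≡cw = efficient v v>0 (λ i j → subst₂ (λ a b → abs (M i j - v i / v j) ≤ abs (M i j - a / b))
                                                          (sym (w≗w′ i)) (sym (w≗w′ j)) (v≽w′ i j))
    in c , 0<c , λ i → trans (v≡cw i) (cong (c *_) (w≗w′ i))

  module Sum = Algebra.Properties.CommutativeMonoid.Sum (CommutativeRing.+-commutativeMonoid commutativeRing)
  module SumDistrib = Algebra.Properties.Semiring.Sum (CommutativeRing.semiring commutativeRing)

  sumF≡sum : ∀ n f → sumF n f ≡ Sum.sum f
  sumF≡sum zero f = refl
  sumF≡sum (suc n) f = cong (f Fin.zero +_) (sumF≡sum n (f ∘ Fin.suc))

  sumF-cong : ∀ n {f g} → (∀ j → f j ≡ g j) → sumF n f ≡ sumF n g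
  sumF-cong n {f} {g} f≗g = trans (sumF≡sum n f) (trans (Sum.sum-cong-≗ f≗g) (sym (sumF≡sum n g)))

  sumF-*ʳ : ∀ n f x → sumF n f * x ≡ sumF n (λ j → f j * x)
  sumF-*ʳ n f x = trans (cong (_* x) (sumF≡sum n f)) (trans (SumDistrib.*-distribʳ-sum x f) (sym (sumF≡sum n _)))

  sumF-permute : ∀ n f (π : Permutation′ n) → sumF n (λ j → f (π ⟨$⟩ʳ j)) ≡ sumF n f
  sumF-permute n f π = trans (sumF≡sum n _) (trans (sym (Sum.sum-permute f π)) (sym (sumF≡sum n f)))

  sumF-zero : ∀ n {f} → (∀ j → f j ≡ 0#) → sumF n f ≡ 0#
  sumF-zero zero f≡0 = refl
  sumF-zero (suc n) f≡0 = trans (cong₂ _+_ (f≡0 Fin.zero) (sumF-zero n (f≡0 ∘ Fin.suc))) (+-identityˡ 0#)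

  sumF-nonneg : ∀ n {f} → (∀ j → 0# ≤ f j) → 0# ≤ sumF n f
  sumF-nonneg zero f≥0 = ≤-refl
  sumF-nonneg (suc n) f≥0 = +-nonneg (f≥0 Fin.zero) (sumF-nonneg n (f≥0 ∘ Fin.suc))

  sumF-pos : ∀ n {f} → (∀ j → 0# ≤ f j) → ∀ j → 0# < f j → 0# < sumF n f
  sumF-pos (suc n) f≥0 Fin.zero 0<f0 = +-pos-nonneg 0<f0 (sumF-nonneg n (f≥0 ∘ Fin.suc))
  sumF-pos (suc n) {f} f≥0 (Fin.suc j) 0<fj = subst (0# <_) (+-comm _ (f Fin.zero))
    (+-pos-nonneg (sumF-pos n (f≥0 ∘ Fin.suc) j 0<fj) (f≥0 Fin.zero))

  inCone-positive : ∀ {n} {M : Matrix n} {w} → (∀ i j → 0# < M i j) → InCone M w → Positive w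
  inCone-positive M>0 (c , c≥0 , (j , cⱼ≢0) , w≡Mc) i = subst (0# <_) (sym (w≡Mc i))
    (sumF-pos _ (λ l → *-nonneg (c≥0 l) (inj₁ (M>0 i l))) j (*-pos _ _ 0<cⱼ (M>0 i j)))
    where
    0<cⱼ : 0# < c j
    0<cⱼ = [ (λ 0<cⱼ → 0<cⱼ) , (λ 0≡cⱼ → contradiction (sym 0≡cⱼ) cⱼ≢0) ]′ (c≥0 j)

  -- Monomial similarity

  module Similarity {n} {A R : Matrix n} (A∼R : MonomiallySimilar A R) where
    π : Permutation′ n
    π = proj₁ A∼R

    d : Vector n
    d = proj₁ (proj₂ A∼R)

    d>0 : Positive d
    d>0 = proj₁ (proj₂ (proj₂ A∼R))

    A≡dRd⁻¹ : ∀ i j → A i j ≡ (d i * R (π ⟨$⟩ʳ i) (π ⟨$⟩ʳ j)) / d j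
    A≡dRd⁻¹ = proj₂ (proj₂ (proj₂ A∼R))

    σ : Fin n → Fin n
    σ k = π ⟨$⟩ˡ k

    twist : Vector n → Vector n
    twist w i = d i * w (π ⟨$⟩ʳ i)

    untwist : Vector n → Vector n
    untwist w k = w (σ k) / d (σ k)

    twist-untwist : ∀ w i → twist (untwist w) i ≡ w i
    twist-untwist w i = begin
      d i * (w (σ (π ⟨$⟩ʳ i)) / d (σ (π ⟨$⟩ʳ i)))  ≡⟨ cong (λ j → d i * (w j / d j)) (inverseˡ π) ⟩
      d i * (w i / d i)                            ≡⟨ solve 3 (λ d w d′ → d :* (w :* d′) := w :* d′ :* d) refl (d i) (w i) (d i ⁻¹) ⟩
      w i / d i * d i                              ≡⟨ x*y⁻¹*y≡x (d>0 i) (w i) ⟩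
      w i                                          ∎

    deviation : ∀ {x} → Positive x → ∀ i j →
                A i j - twist x i / twist x j ≡ (d i / d j) * (R (π ⟨$⟩ʳ i) (π ⟨$⟩ʳ j) - x (π ⟨$⟩ʳ i) / x (π ⟨$⟩ʳ j))
    deviation {x} x>0 i j = begin
      A i j - twist x i / twist x j
        ≡⟨ cong₂ (λ a b → a - twist x i * b) (A≡dRd⁻¹ i j) (⁻¹-distrib-* (>0⇒≢0 (d>0 j)) (>0⇒≢0 (x>0 _))) ⟩
      (d i * r) / d j - (d i * y) * (d j ⁻¹ * z ⁻¹)
        ≡⟨ solve 5 (λ dᵢ dⱼ′ r y z′ → dᵢ :* r :* dⱼ′ :- dᵢ :* y :* (dⱼ′ :* z′) := dᵢ :* dⱼ′ :* (r :- y :* z′)) refl (d i) (d j ⁻¹) r y (z ⁻¹) ⟩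
      (d i / d j) * (r - y / z) ∎
      where
      r y z : Carrier
      r = R (π ⟨$⟩ʳ i) (π ⟨$⟩ʳ j)
      y = x (π ⟨$⟩ʳ i)
      z = x (π ⟨$⟩ʳ j)

    twist-positive : ∀ {w} → Positive w → Positive (twist w)
    twist-positive w>0 i = *-pos _ _ (d>0 i) (w>0 _)

    untwist-positive : ∀ {w} → Positive w → Positive (untwist w)
    untwist-positive w>0 k = *-pos _ _ (w>0 _) (⁻¹-pos (d>0 _))

    dominates-untwist : ∀ {v w} → Positive v → Positive w → Dominates A v (twist w) → Dominates R (untwist v) w
    dominates-untwist {v} {w} v>0 w>0 v≽w k l =
      subst₂ (λ k l → abs (R k l - u k / u l) ≤ abs (R k l - w k / w l)) (inverseʳ π) (inverseʳ π) at-image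
      where
      u : Vector n
      u = untwist v
      i j : Fin n
      i = σ k
      j = σ l
      0<dᵢ/dⱼ : 0# < d i / d j
      0<dᵢ/dⱼ = *-pos _ _ (d>0 i) (⁻¹-pos (d>0 j))
      scaled : ∀ {x} → Positive x → abs (A i j - twist x i / twist x j) ≡
               (d i / d j) * abs (R (π ⟨$⟩ʳ i) (π ⟨$⟩ʳ j) - x (π ⟨$⟩ʳ i) / x (π ⟨$⟩ʳ j))
      scaled x>0 = trans (cong abs (deviation x>0 i j)) (abs-*-pos _ 0<dᵢ/dⱼ)
      at-image : abs (R (π ⟨$⟩ʳ i) (π ⟨$⟩ʳ j) - u (π ⟨$⟩ʳ i) / u (π ⟨$⟩ʳ j)) ≤
                 abs (R (π ⟨$⟩ʳ i) (π ⟨$⟩ʳ j) - w (π ⟨$⟩ʳ i) / w (π ⟨$⟩ʳ j))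
      at-image = *-cancelˡ-≤ 0<dᵢ/dⱼ (subst₂ _≤_ (scaled (untwist-positive v>0)) (scaled w>0)
        (subst₂ (λ a b → abs (A i j - a / b) ≤ abs (A i j - twist w i / twist w j)) (sym (twist-untwist v i)) (sym (twist-untwist v j)) (v≽w i j)))

    efficient-twist : ∀ {w} → Efficient R w → Efficient A (twist w)
    efficient-twist {w} (w>0 , efficient) = twist-positive w>0 , λ v v>0 v≽w →
      let c , 0<c , u≡cw = efficient (untwist v) (untwist-positive v>0) (dominates-untwist v>0 w>0 v≽w)
      in c , 0<c , λ i → begin
        v i                       ≡⟨ twist-untwist v i ⟨
        d i * untwist v (π ⟨$⟩ʳ i) ≡⟨ cong (d i *_) (u≡cw _) ⟩
        d i * (c * w (π ⟨$⟩ʳ i))   ≡⟨ solve 3 (λ d c w → d :* (c :* w) := c :* (d :* w)) refl (d i) c _ ⟩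
        c * twist w i             ∎

    inCone-untwist : ∀ {w} → InCone A w → InCone R (untwist w)
    inCone-untwist {w} (c , c≥0 , (j₀ , cⱼ₀≢0) , w≡Ac) = untwist c , untwist-c≥0 , (π ⟨$⟩ʳ j₀ , untwist-c≢0) , untwist-w≡Rc
      where
      untwist-c≥0 : ∀ l → 0# ≤ untwist c l
      untwist-c≥0 l = *-nonneg (c≥0 _) (inj₁ (⁻¹-pos (d>0 _)))
      untwist-c≢0 : untwist c (π ⟨$⟩ʳ j₀) ≢ 0#
      untwist-c≢0 c/d≡0 = cⱼ₀≢0 (begin
        c j₀                           ≡⟨ cong c (inverseˡ π) ⟨
        c (σ (π ⟨$⟩ʳ j₀))               ≡⟨ x*y⁻¹*y≡x (d>0 _) _ ⟨
        untwist c (π ⟨$⟩ʳ j₀) * d (σ (π ⟨$⟩ʳ j₀)) ≡⟨ cong (_* d (σ (π ⟨$⟩ʳ j₀))) c/d≡0 ⟩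
        0# * d (σ (π ⟨$⟩ʳ j₀))           ≡⟨ zeroˡ _ ⟩
        0#                             ∎)
      termwise : ∀ k j → c j * A (σ k) j * d (σ k) ⁻¹ ≡ untwist c (π ⟨$⟩ʳ j) * R k (π ⟨$⟩ʳ j)
      termwise k j = begin
        c j * A (σ k) j * d (σ k) ⁻¹
          ≡⟨ cong (λ a → c j * a * d (σ k) ⁻¹) (trans (A≡dRd⁻¹ (σ k) j) (cong (λ i → (d (σ k) * R i _) / d j) (inverseʳ π))) ⟩
        c j * ((d (σ k) * R k (π ⟨$⟩ʳ j)) / d j) * d (σ k) ⁻¹
          ≡⟨ solve 5 (λ c D r e′ D′ → c :* (D :* r :* e′) :* D′ := c :* e′ :* r :* (D :* D′)) refl (c j) (d (σ k)) _ (d j ⁻¹) _ ⟩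
        c j / d j * R k (π ⟨$⟩ʳ j) * (d (σ k) * d (σ k) ⁻¹)
          ≡⟨ trans (cong (c j / d j * R k (π ⟨$⟩ʳ j) *_) (x*x⁻¹≡1 (d>0 _))) (*-identityʳ _) ⟩
        c j / d j * R k (π ⟨$⟩ʳ j)
          ≡⟨ cong (λ i → c i / d i * R k (π ⟨$⟩ʳ j)) (inverseˡ π) ⟨
        untwist c (π ⟨$⟩ʳ j) * R k (π ⟨$⟩ʳ j) ∎
      untwist-w≡Rc : ∀ k → untwist w k ≡ sumF n (λ l → untwist c l * R k l)
      untwist-w≡Rc k = begin
        w (σ k) * d (σ k) ⁻¹                                  ≡⟨ cong (_* d (σ k) ⁻¹) (w≡Ac (σ k)) ⟩
        sumF n (λ j → c j * A (σ k) j) * d (σ k) ⁻¹           ≡⟨ sumF-*ʳ n _ _ ⟩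
        sumF n (λ j → c j * A (σ k) j * d (σ k) ⁻¹)           ≡⟨ sumF-cong n (termwise k) ⟩
        sumF n (λ j → untwist c (π ⟨$⟩ʳ j) * R k (π ⟨$⟩ʳ j))  ≡⟨ sumF-permute n (λ l → untwist c l * R k l) π ⟩
        sumF n (λ l → untwist c l * R k l)                     ∎

    reciprocal : Reciprocal R → Reciprocal A
    reciprocal (R>0 , R-reciprocal) = A>0 , A-reciprocal
      where
      A>0 : ∀ i j → 0# < A i j
      A>0 i j = subst (0# <_) (sym (A≡dRd⁻¹ i j)) (*-pos _ _ (*-pos _ _ (d>0 i) (R>0 _ _)) (⁻¹-pos (d>0 j)))
      A-reciprocal : ∀ i j → A j i ≡ 1# / A i j
      A-reciprocal i j = begin
        A j i                                 ≡⟨ A≡dRd⁻¹ j i ⟩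
        (d j * R (π ⟨$⟩ʳ j) (π ⟨$⟩ʳ i)) / d i  ≡⟨ cong (λ r → (d j * r) / d i) (R-reciprocal _ _) ⟩
        (d j * (1# / r)) / d i                ≡⟨ solve 4 (λ dⱼ r′ dᵢ′ e → dⱼ :* (e :* r′) :* dᵢ′ := e :* (dᵢ′ :* r′ :* dⱼ)) refl (d j) (r ⁻¹) (d i ⁻¹) 1# ⟩
        1# * (d i ⁻¹ * r ⁻¹ * d j)            ≡⟨ cong (1# *_) inverse ⟨
        1# / ((d i * r) / d j)                ≡⟨ cong (1# /_) (A≡dRd⁻¹ i j) ⟨
        1# / A i j                            ∎
        where
        r : Carrier
        r = R (π ⟨$⟩ʳ i) (π ⟨$⟩ʳ j)
        inverse : ((d i * r) / d j) ⁻¹ ≡ d i ⁻¹ * r ⁻¹ * d j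
        inverse = begin
          ((d i * r) * d j ⁻¹) ⁻¹       ≡⟨ ⁻¹-distrib-* (>0⇒≢0 (*-pos _ _ (d>0 i) (R>0 _ _))) (>0⇒≢0 (⁻¹-pos (d>0 j))) ⟩
          (d i * r) ⁻¹ * d j ⁻¹ ⁻¹     ≡⟨ cong₂ _*_ (⁻¹-distrib-* (>0⇒≢0 (d>0 i)) (>0⇒≢0 (R>0 _ _))) (⁻¹-involutive (>0⇒≢0 (d>0 j))) ⟩
          d i ⁻¹ * r ⁻¹ * d j          ∎

    symmetric : MonomiallySimilar R A
    symmetric = flip π , d⁻¹∘σ , (λ k → ⁻¹-pos (d>0 (σ k))) , R≡
      where
      d⁻¹∘σ : Vector n
      d⁻¹∘σ k = d (σ k) ⁻¹
      R≡ : ∀ k l → R k l ≡ (d⁻¹∘σ k * A (σ k) (σ l)) / d⁻¹∘σ l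
      R≡ k l = sym (begin
        (d (σ k) ⁻¹ * A (σ k) (σ l)) * d (σ l) ⁻¹ ⁻¹
          ≡⟨ cong₂ (λ a b → (d (σ k) ⁻¹ * a) * b) (A≡dRd⁻¹ (σ k) (σ l)) (⁻¹-involutive (>0⇒≢0 (d>0 (σ l)))) ⟩
        (d (σ k) ⁻¹ * ((d (σ k) * R (π ⟨$⟩ʳ σ k) (π ⟨$⟩ʳ σ l)) / d (σ l))) * d (σ l)
          ≡⟨ solve 5 (λ D′ D r E′ E → D′ :* (D :* r :* E′) :* E := r :* (D :* D′) :* (E :* E′)) refl _ (d (σ k)) _ _ (d (σ l)) ⟩
        R (π ⟨$⟩ʳ σ k) (π ⟨$⟩ʳ σ l) * (d (σ k) * d (σ k) ⁻¹) * (d (σ l) * d (σ l) ⁻¹)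
          ≡⟨ cong₂ (λ a b → R (π ⟨$⟩ʳ σ k) (π ⟨$⟩ʳ σ l) * a * b) (x*x⁻¹≡1 (d>0 _)) (x*x⁻¹≡1 (d>0 _)) ⟩
        R (π ⟨$⟩ʳ σ k) (π ⟨$⟩ʳ σ l) * 1# * 1#
          ≡⟨ trans (*-identityʳ _) (*-identityʳ _) ⟩
        R (π ⟨$⟩ʳ σ k) (π ⟨$⟩ʳ σ l)
          ≡⟨ cong₂ R (inverseʳ π) (inverseʳ π) ⟩
        R k l ∎)

  coneInEfficient-transfer : ∀ {n} {A R : Matrix n} → MonomiallySimilar A R → ConeInEfficient R → ConeInEfficient A
  coneInEfficient-transfer {A = A} {R} A∼R cone⊆efficient w w∈cone =
    efficient-cong (twist-untwist w) (efficient-twist (cone⊆efficient (untwist w) (inCone-untwist w∈cone)))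
    where open Similarity {A = A} {R} A∼R

  coneInEfficient-similar : ∀ {n} {A R : Matrix n} → MonomiallySimilar A R → ConeInEfficient R ⇔ ConeInEfficient A
  coneInEfficient-similar A∼R =
    mk⇔ (coneInEfficient-transfer A∼R) (coneInEfficient-transfer (Similarity.symmetric A∼R))

  -- Closed walks

  module Walks {n} (ρ : Fin n → Carrier) where
    open import Data.List.Membership.DecPropositional (Fin._≟_ {n}) using (_∈_; _∈?_)

    _≲_ : Fin n → Fin n → Set
    i ≲ j = ρ i ≤ ρ j

    Walk : Fin n → Fin n → Set
    Walk = Star _≲_

    vertices : ∀ {i j} → Walk i j → List (Fin n)
    vertices {i} ε = i ∷ []
    vertices {i} (_ ◅ p) = i ∷ vertices p

    Spanning : ∀ {i j} → Walk i j → Set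
    Spanning p = True (all? (λ x → x ∈? vertices p))

    walk-≤ : ∀ {i j} → Walk i j → ρ i ≤ ρ j
    walk-≤ = Star.fold _≲_ ≤-trans ≤-refl

    visited-between : ∀ {i j x} (p : Walk i j) → x ∈ vertices p → ρ i ≤ ρ x × ρ x ≤ ρ j
    visited-between ε (here refl) = ≤-refl , ≤-refl
    visited-between (i≲k ◅ p) (here refl) = ≤-refl , walk-≤ (i≲k ◅ p)
    visited-between (i≲k ◅ p) (there x∈p) = let k≲x , x≲j = visited-between p x∈p in ≤-trans i≲k k≲x , x≲j

    closed-walk-constant : ∀ {i} (p : Walk i i) {_ : Spanning p} → ∀ x y → ρ x ≡ ρ y
    closed-walk-constant {i} p {spanning} x y = trans (≡ρᵢ x) (sym (≡ρᵢ y))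
      where
      ≡ρᵢ : ∀ x → ρ x ≡ ρ i
      ≡ρᵢ x = let i≲x , x≲i = visited-between p (toWitness spanning x) in ≤-antisym x≲i i≲x

  -- The block matrix

  module Block (α β γ : Carrier) where
    B : Fin 5 → Fin 5 → Carrier
    B = blockA 5 α β γ

    Exceptional : Set
    Exceptional = (1# < γ × γ < β × β < α) ⊎ (γ < 1# × 1# < α × α < β)

    module Syntax = Rows (expressions 8) renaming (row to row′; lin to lin′)

    module Gaps (X₀ X₁ x₂ x₃ T : Carrier) where
      open Rows (CommutativeRing.rawRing commutativeRing) α β γ X₀ X₁ x₂ x₃ T public using (a₀; a₁; b₂; b₃; row; lin)

      gap : Fin 5 → Fin 5 → Carrier
      gap i j = row i - B i j * row j

      gap₀₁ : gap 0F 1F ≡ lin 0# 0# (α - 1#) (β - γ) 0#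
      gap₀₁ = solve 8 (λ α β γ X₀ X₁ x₂ x₃ T → let open Syntax α β γ X₀ X₁ x₂ x₃ T in
        row′ 0F :- :1 :* row′ 1F := lin′ :0 :0 (α :- :1) (β :- γ) :0) refl α β γ X₀ X₁ x₂ x₃ T

      gap₀₂ : gap 0F 2F ≡ lin 0# (γ * (1# - α)) 0# (β - α) (1# - α)
      gap₀₂ = solve 8 (λ α β γ X₀ X₁ x₂ x₃ T → let open Syntax α β γ X₀ X₁ x₂ x₃ T in
        row′ 0F :- α :* row′ 2F := lin′ :0 (γ :* (:1 :- α)) :0 (β :- α) (:1 :- α)) refl α β γ X₀ X₁ x₂ x₃ T

      gap₀₃ : gap 0F 3F ≡ lin 0# (γ - β) (α - β) 0# (1# - β)
      gap₀₃ = solve 8 (λ α β γ X₀ X₁ x₂ x₃ T → let open Syntax α β γ X₀ X₁ x₂ x₃ T in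
        row′ 0F :- β :* row′ 3F := lin′ :0 (γ :- β) (α :- β) :0 (:1 :- β)) refl α β γ X₀ X₁ x₂ x₃ T

      gap₀₄ : gap 0F 4F ≡ lin 0# 0# (α - 1#) (β - 1#) 0#
      gap₀₄ = solve 8 (λ α β γ X₀ X₁ x₂ x₃ T → let open Syntax α β γ X₀ X₁ x₂ x₃ T in
        row′ 0F :- :1 :* row′ 4F := lin′ :0 :0 (α :- :1) (β :- :1) :0) refl α β γ X₀ X₁ x₂ x₃ T

      gap₁₂ : gap 1F 2F ≡ lin (β * (α - 1#)) 0# 0# (γ - 1#) 0#
      gap₁₂ = solve 8 (λ α β γ X₀ X₁ x₂ x₃ T → let open Syntax α β γ X₀ X₁ x₂ x₃ T in
        row′ 1F :- :1 :* row′ 2F := lin′ (β :* (α :- :1)) :0 :0 (γ :- :1) :0) refl α β γ X₀ X₁ x₂ x₃ T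

      gap₁₃ : gap 1F 3F ≡ lin (α * (β - γ)) 0# (1# - γ) 0# (1# - γ)
      gap₁₃ = solve 8 (λ α β γ X₀ X₁ x₂ x₃ T → let open Syntax α β γ X₀ X₁ x₂ x₃ T in
        row′ 1F :- γ :* row′ 3F := lin′ (α :* (β :- γ)) :0 (:1 :- γ) :0 (:1 :- γ)) refl α β γ X₀ X₁ x₂ x₃ T

      gap₁₄ : gap 1F 4F ≡ lin 0# 0# 0# (γ - 1#) 0#
      gap₁₄ = solve 8 (λ α β γ X₀ X₁ x₂ x₃ T → let open Syntax α β γ X₀ X₁ x₂ x₃ T in
        row′ 1F :- :1 :* row′ 4F := lin′ :0 :0 :0 (γ :- :1) :0) refl α β γ X₀ X₁ x₂ x₃ T

      gap₂₃ : gap 2F 3F ≡ lin (β - α) (γ - 1#) 0# 0# 0#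
      gap₂₃ = solve 8 (λ α β γ X₀ X₁ x₂ x₃ T → let open Syntax α β γ X₀ X₁ x₂ x₃ T in
        row′ 2F :- :1 :* row′ 3F := lin′ (β :- α) (γ :- :1) :0 :0 :0) refl α β γ X₀ X₁ x₂ x₃ T

      gap₂₄ : gap 2F 4F ≡ lin (β * (1# - α)) 0# 0# 0# 0#
      gap₂₄ = solve 8 (λ α β γ X₀ X₁ x₂ x₃ T → let open Syntax α β γ X₀ X₁ x₂ x₃ T in
        row′ 2F :- :1 :* row′ 4F := lin′ (β :* (:1 :- α)) :0 :0 :0 :0) refl α β γ X₀ X₁ x₂ x₃ T

      gap₃₄ : gap 3F 4F ≡ lin (α * (1# - β)) (1# - γ) 0# 0# 0#
      gap₃₄ = solve 8 (λ α β γ X₀ X₁ x₂ x₃ T → let open Syntax α β γ X₀ X₁ x₂ x₃ T in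
        row′ 3F :- :1 :* row′ 4F := lin′ (α :* (:1 :- β)) (:1 :- γ) :0 :0 :0) refl α β γ X₀ X₁ x₂ x₃ T

      gap-combination₀ : (β - α) * gap 0F 1F + (γ - β) * gap 0F 2F + γ * (α - 1#) * gap 0F 3F ≡
                         lin 0# 0# ((β - α) * (α - 1#) * (1# - γ)) 0# ((γ - β) * (1# - α) + γ * (α - 1#) * (1# - β))
      gap-combination₀ = solve 8 (λ α β γ X₀ X₁ x₂ x₃ T → let open Syntax α β γ X₀ X₁ x₂ x₃ T in
        (β :- α) :* (row′ 0F :- :1 :* row′ 1F) :+ (γ :- β) :* (row′ 0F :- α :* row′ 2F) :+ γ :* (α :- :1) :* (row′ 0F :- β :* row′ 3F)
          := lin′ :0 :0 ((β :- α) :* (α :- :1) :* (:1 :- γ)) :0 ((γ :- β) :* (:1 :- α) :+ γ :* (α :- :1) :* (:1 :- β))) refl α β γ X₀ X₁ x₂ x₃ T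

      gap-combination₁ : α * (γ - 1#) * gap 1F 0F + α * (β - γ) * gap 1F 2F + β * (1# - α) * gap 1F 3F ≡
                         lin 0# 0# ((1# - α) * (γ - 1#) * (α - β)) 0# (β * (1# - α) * (1# - γ))
      gap-combination₁ = solve 8 (λ α β γ X₀ X₁ x₂ x₃ T → let open Syntax α β γ X₀ X₁ x₂ x₃ T in
        α :* (γ :- :1) :* (row′ 1F :- :1 :* row′ 0F) :+ α :* (β :- γ) :* (row′ 1F :- :1 :* row′ 2F) :+ β :* (:1 :- α) :* (row′ 1F :- γ :* row′ 3F)
          := lin′ :0 :0 ((:1 :- α) :* (γ :- :1) :* (α :- β)) :0 (β :* (:1 :- α) :* (:1 :- γ))) refl α β γ X₀ X₁ x₂ x₃ T

      module Connected (0<α : 0# < α) (0<γ : 0# < γ) (1≤β : 1# ≤ β)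
                       (0≤X₀ : 0# ≤ X₀) (0≤X₁ : 0# ≤ X₁) (0≤x₂ : 0# ≤ x₂) (0≤x₃ : 0# ≤ x₃) (0≤T : 0# ≤ T)
                       (ρ : Fin 5 → Carrier)
                       (ρ-mono : ∀ {i j} → B i j * row j ≤ row i → ρ i ≤ ρ j)
                       (ρ-antitone : ∀ {i j} → row i ≤ B i j * row j → ρ j ≤ ρ i) where
        open Walks ρ

        lin-nonneg : ∀ {c₀ c₁ c₂ c₃ c₄} → 0# ≤ c₀ → 0# ≤ c₁ → 0# ≤ c₂ → 0# ≤ c₃ → 0# ≤ c₄ → 0# ≤ lin c₀ c₁ c₂ c₃ c₄
        lin-nonneg 0≤c₀ 0≤c₁ 0≤c₂ 0≤c₃ 0≤c₄ = +-nonneg (+-nonneg (+-nonneg (+-nonneg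
          (*-nonneg 0≤c₀ 0≤X₀) (*-nonneg 0≤c₁ 0≤X₁)) (*-nonneg 0≤c₂ 0≤x₂)) (*-nonneg 0≤c₃ 0≤x₃)) (*-nonneg 0≤c₄ 0≤T)

        lin-nonpos : ∀ {c₀ c₁ c₂ c₃ c₄} → c₀ ≤ 0# → c₁ ≤ 0# → c₂ ≤ 0# → c₃ ≤ 0# → c₄ ≤ 0# → lin c₀ c₁ c₂ c₃ c₄ ≤ 0#
        lin-nonpos c₀≤0 c₁≤0 c₂≤0 c₃≤0 c₄≤0 = +-nonpos (+-nonpos (+-nonpos (+-nonpos
          (*-nonpos-nonneg c₀≤0 0≤X₀) (*-nonpos-nonneg c₁≤0 0≤X₁)) (*-nonpos-nonneg c₂≤0 0≤x₂)) (*-nonpos-nonneg c₃≤0 0≤x₃)) (*-nonpos-nonneg c₄≤0 0≤T)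

        gap≤0⇒ρ≥ : ∀ {i j} → gap i j ≤ 0# → ρ j ≤ ρ i
        gap≤0⇒ρ≥ gap≤0 = ρ-antitone (x-y≤0⇒x≤y gap≤0)

        ascending : ∀ {i j c₀ c₁ c₂ c₃ c₄} → gap i j ≡ lin c₀ c₁ c₂ c₃ c₄ →
                    0# ≤ c₀ → 0# ≤ c₁ → 0# ≤ c₂ → 0# ≤ c₃ → 0# ≤ c₄ → ρ i ≤ ρ j
        ascending gap≡lin 0≤c₀ 0≤c₁ 0≤c₂ 0≤c₃ 0≤c₄ =
          ρ-mono (0≤y-x⇒x≤y (subst (0# ≤_) (sym gap≡lin) (lin-nonneg 0≤c₀ 0≤c₁ 0≤c₂ 0≤c₃ 0≤c₄)))

        descending : ∀ {i j c₀ c₁ c₂ c₃ c₄} → gap i j ≡ lin c₀ c₁ c₂ c₃ c₄ →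
                     c₀ ≤ 0# → c₁ ≤ 0# → c₂ ≤ 0# → c₃ ≤ 0# → c₄ ≤ 0# → ρ j ≤ ρ i
        descending gap≡lin c₀≤0 c₁≤0 c₂≤0 c₃≤0 c₄≤0 =
          gap≤0⇒ρ≥ (subst (_≤ 0#) (sym gap≡lin) (lin-nonpos c₀≤0 c₁≤0 c₂≤0 c₃≤0 c₄≤0))

        0≤α : 0# ≤ α
        0≤α = inj₁ 0<α

        0≤β : 0# ≤ β
        0≤β = inj₁ (<-≤-trans 0<1 1≤β)

        0≤γ : 0# ≤ γ
        0≤γ = inj₁ 0<γ

        ρ₀≤ρ₂ : α ≤ 1# → ρ 0F ≤ ρ 2F
        ρ₀≤ρ₂ α≤1 = ascending gap₀₂ ≤-refl (*-nonneg 0≤γ (x≤y⇒0≤y-x α≤1)) ≤-refl (x≤y⇒0≤y-x (≤-trans α≤1 1≤β)) (x≤y⇒0≤y-x α≤1)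

        ρ₂≤ρ₀ : β ≤ α → ρ 2F ≤ ρ 0F
        ρ₂≤ρ₀ β≤α = descending gap₀₂ ≤-refl (*-nonneg-nonpos 0≤γ (x≤y⇒x-y≤0 1≤α)) ≤-refl (x≤y⇒x-y≤0 β≤α) (x≤y⇒x-y≤0 1≤α)
          where
          1≤α : 1# ≤ α
          1≤α = ≤-trans 1≤β β≤α

        ρ₂≤ρ₄ : α ≤ 1# → ρ 2F ≤ ρ 4F
        ρ₂≤ρ₄ α≤1 = ascending gap₂₄ (*-nonneg 0≤β (x≤y⇒0≤y-x α≤1)) ≤-refl ≤-refl ≤-refl ≤-refl

        ρ₄≤ρ₂ : 1# ≤ α → ρ 4F ≤ ρ 2F
        ρ₄≤ρ₂ 1≤α = descending gap₂₄ (*-nonneg-nonpos 0≤β (x≤y⇒x-y≤0 1≤α)) ≤-refl ≤-refl ≤-refl ≤-refl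

        ρ₁≤ρ₄ : 1# ≤ γ → ρ 1F ≤ ρ 4F
        ρ₁≤ρ₄ 1≤γ = ascending gap₁₄ ≤-refl ≤-refl ≤-refl (x≤y⇒0≤y-x 1≤γ) ≤-refl

        ρ₄≤ρ₁ : γ ≤ 1# → ρ 4F ≤ ρ 1F
        ρ₄≤ρ₁ γ≤1 = descending gap₁₄ ≤-refl ≤-refl ≤-refl (x≤y⇒x-y≤0 γ≤1) ≤-refl

        ρ₁≤ρ₃ : γ ≤ 1# → ρ 1F ≤ ρ 3F
        ρ₁≤ρ₃ γ≤1 = ascending gap₁₃ (*-nonneg 0≤α (x≤y⇒0≤y-x (≤-trans γ≤1 1≤β))) ≤-refl (x≤y⇒0≤y-x γ≤1) ≤-refl (x≤y⇒0≤y-x γ≤1)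

        ρ₃≤ρ₁ : β ≤ γ → ρ 3F ≤ ρ 1F
        ρ₃≤ρ₁ β≤γ = descending gap₁₃ (*-nonneg-nonpos 0≤α (x≤y⇒x-y≤0 β≤γ)) ≤-refl (x≤y⇒x-y≤0 1≤γ) ≤-refl (x≤y⇒x-y≤0 1≤γ)
          where
          1≤γ : 1# ≤ γ
          1≤γ = ≤-trans 1≤β β≤γ

        ρ₃≤ρ₀ : γ ≤ β → α ≤ β → ρ 3F ≤ ρ 0F
        ρ₃≤ρ₀ γ≤β α≤β = descending gap₀₃ ≤-refl (x≤y⇒x-y≤0 γ≤β) (x≤y⇒x-y≤0 α≤β) ≤-refl (x≤y⇒x-y≤0 1≤β)

        ρ₄≤ρ₃ : 1# ≤ γ → ρ 4F ≤ ρ 3F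
        ρ₄≤ρ₃ 1≤γ = descending gap₃₄ (*-nonneg-nonpos 0≤α (x≤y⇒x-y≤0 1≤β)) (x≤y⇒x-y≤0 1≤γ) ≤-refl ≤-refl ≤-refl

        ρ₁≤ρ₀ : α ≤ 1# → β ≤ γ → ρ 1F ≤ ρ 0F
        ρ₁≤ρ₀ α≤1 β≤γ = descending gap₀₁ ≤-refl ≤-refl (x≤y⇒x-y≤0 α≤1) (x≤y⇒x-y≤0 β≤γ) ≤-refl

        ρ₀≤ρ₁ : 1# ≤ α → γ ≤ β → ρ 0F ≤ ρ 1F
        ρ₀≤ρ₁ 1≤α γ≤β = ascending gap₀₁ ≤-refl ≤-refl (x≤y⇒0≤y-x 1≤α) (x≤y⇒0≤y-x γ≤β) ≤-refl

        ρ₂≤ρ₃ : α ≤ β → 1# ≤ γ → ρ 2F ≤ ρ 3F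
        ρ₂≤ρ₃ α≤β 1≤γ = ascending gap₂₃ (x≤y⇒0≤y-x α≤β) (x≤y⇒0≤y-x 1≤γ) ≤-refl ≤-refl ≤-refl

        ρ₃≤ρ₂ : β ≤ α → γ ≤ 1# → ρ 3F ≤ ρ 2F
        ρ₃≤ρ₂ β≤α γ≤1 = descending gap₂₃ (x≤y⇒x-y≤0 β≤α) (x≤y⇒x-y≤0 γ≤1) ≤-refl ≤-refl ≤-refl

        ρ₀≤ρ₄ : 1# ≤ α → ρ 0F ≤ ρ 4F
        ρ₀≤ρ₄ 1≤α = ascending gap₀₄ ≤-refl ≤-refl (x≤y⇒0≤y-x 1≤α) (x≤y⇒0≤y-x 1≤β) ≤-refl

        ρ₁≤ρ₂ : 1# ≤ α → 1# ≤ γ → ρ 1F ≤ ρ 2F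
        ρ₁≤ρ₂ 1≤α 1≤γ = ascending gap₁₂ (*-nonneg 0≤β (x≤y⇒0≤y-x 1≤α)) ≤-refl ≤-refl (x≤y⇒0≤y-x 1≤γ) ≤-refl

        cycle-α≤1-γ≤1 : α ≤ 1# → γ ≤ 1# → ∀ x y → ρ x ≡ ρ y
        cycle-α≤1-γ≤1 α≤1 γ≤1 = closed-walk-constant
          (ρ₀≤ρ₂ α≤1 ◅ ρ₂≤ρ₄ α≤1 ◅ ρ₄≤ρ₁ γ≤1 ◅ ρ₁≤ρ₃ γ≤1 ◅ ρ₃≤ρ₀ (≤-trans γ≤1 1≤β) (≤-trans α≤1 1≤β) ◅ ε)

        cycle-α≤1-β≤γ : α ≤ 1# → β ≤ γ → ∀ x y → ρ x ≡ ρ y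
        cycle-α≤1-β≤γ α≤1 β≤γ = closed-walk-constant
          (ρ₀≤ρ₂ α≤1 ◅ ρ₂≤ρ₄ α≤1 ◅ ρ₄≤ρ₃ (≤-trans 1≤β β≤γ) ◅ ρ₃≤ρ₁ β≤γ ◅ ρ₁≤ρ₀ α≤1 β≤γ ◅ ε)

        cycle-1≤α≤β-1≤γ≤β : 1# ≤ α → α ≤ β → 1# ≤ γ → γ ≤ β → ∀ x y → ρ x ≡ ρ y
        cycle-1≤α≤β-1≤γ≤β 1≤α α≤β 1≤γ γ≤β = closed-walk-constant
          (ρ₀≤ρ₁ 1≤α γ≤β ◅ ρ₁≤ρ₄ 1≤γ ◅ ρ₄≤ρ₂ 1≤α ◅ ρ₂≤ρ₃ α≤β 1≤γ ◅ ρ₃≤ρ₀ γ≤β α≤β ◅ ε)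

        cycle-β≤α-γ≤1 : β ≤ α → γ ≤ 1# → ∀ x y → ρ x ≡ ρ y
        cycle-β≤α-γ≤1 β≤α γ≤1 = closed-walk-constant
          (ρ₀≤ρ₄ (≤-trans 1≤β β≤α) ◅ ρ₄≤ρ₁ γ≤1 ◅ ρ₁≤ρ₃ γ≤1 ◅ ρ₃≤ρ₂ β≤α γ≤1 ◅ ρ₂≤ρ₀ β≤α ◅ ε)

        cycle-β≤α-β≤γ : β ≤ α → β ≤ γ → ∀ x y → ρ x ≡ ρ y
        cycle-β≤α-β≤γ β≤α β≤γ = closed-walk-constant
          (ρ₀≤ρ₄ 1≤α ◅ ρ₄≤ρ₃ 1≤γ ◅ ρ₃≤ρ₁ β≤γ ◅ ρ₁≤ρ₂ 1≤α 1≤γ ◅ ρ₂≤ρ₀ β≤α ◅ ε)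
          where
          1≤α : 1# ≤ α
          1≤α = ≤-trans 1≤β β≤α
          1≤γ : 1# ≤ γ
          1≤γ = ≤-trans 1≤β β≤γ

        walk-1<α<β<γ : 1# < α → α < β → β < γ → ∀ x y → ρ x ≡ ρ y
        walk-1<α<β<γ 1<α α<β β<γ = into-0 (one-of-three-nonpos
          (x<y⇒0<y-x α<β) (x<y⇒0<y-x β<γ) (*-pos _ _ 0<γ (x<y⇒0<y-x 1<α))
          (subst (_≤ 0#) (sym gap-combination₀) (lin-nonpos ≤-refl ≤-refl x₂-coefficient ≤-refl T-coefficient)))
          where
          1≤α : 1# ≤ α
          1≤α = inj₁ 1<α
          α≤β : α ≤ β
          α≤β = inj₁ α<β
          β≤γ : β ≤ γ
          β≤γ = inj₁ β<γ
          1≤γ : 1# ≤ γ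
          1≤γ = ≤-trans 1≤β β≤γ
          x₂-coefficient : (β - α) * (α - 1#) * (1# - γ) ≤ 0#
          x₂-coefficient = *-nonneg-nonpos (*-nonneg (x≤y⇒0≤y-x α≤β) (x≤y⇒0≤y-x 1≤α)) (x≤y⇒x-y≤0 1≤γ)
          T-coefficient : (γ - β) * (1# - α) + γ * (α - 1#) * (1# - β) ≤ 0#
          T-coefficient = +-nonpos (*-nonneg-nonpos (x≤y⇒0≤y-x β≤γ) (x≤y⇒x-y≤0 1≤α))
                                   (*-nonneg-nonpos (*-nonneg 0≤γ (x≤y⇒0≤y-x 1≤α)) (x≤y⇒x-y≤0 1≤β))
          0⇝1 : Walk 0F 1F
          0⇝1 = ρ₀≤ρ₄ 1≤α ◅ ρ₄≤ρ₂ 1≤α ◅ ρ₂≤ρ₃ α≤β 1≤γ ◅ ρ₃≤ρ₁ β≤γ ◅ ε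
          into-0 : gap 0F 1F ≤ 0# ⊎ gap 0F 2F ≤ 0# ⊎ gap 0F 3F ≤ 0# → ∀ x y → ρ x ≡ ρ y
          into-0 (inj₁ gap₀₁≤0) = closed-walk-constant (0⇝1 ◅◅ gap≤0⇒ρ≥ gap₀₁≤0 ◅ ε)
          into-0 (inj₂ (inj₁ gap₀₂≤0)) = closed-walk-constant (0⇝1 ◅◅ ρ₁≤ρ₄ 1≤γ ◅ ρ₄≤ρ₂ 1≤α ◅ gap≤0⇒ρ≥ gap₀₂≤0 ◅ ε)
          into-0 (inj₂ (inj₂ gap₀₃≤0)) =
            closed-walk-constant (0⇝1 ◅◅ ρ₁≤ρ₄ 1≤γ ◅ ρ₄≤ρ₂ 1≤α ◅ ρ₂≤ρ₃ α≤β 1≤γ ◅ gap≤0⇒ρ≥ gap₀₃≤0 ◅ ε)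

        walk-α<1<γ<β : α < 1# → 1# < γ → γ < β → ∀ x y → ρ x ≡ ρ y
        walk-α<1<γ<β α<1 1<γ γ<β = into-1 (one-of-three-nonpos
          (*-pos _ _ 0<α (x<y⇒0<y-x 1<γ)) (*-pos _ _ 0<α (x<y⇒0<y-x γ<β)) (*-pos _ _ (<-≤-trans 0<1 1≤β) (x<y⇒0<y-x α<1))
          (subst (_≤ 0#) (sym gap-combination₁) (lin-nonpos ≤-refl ≤-refl x₂-coefficient ≤-refl T-coefficient)))
          where
          α≤1 : α ≤ 1#
          α≤1 = inj₁ α<1
          1≤γ : 1# ≤ γ
          1≤γ = inj₁ 1<γ
          γ≤β : γ ≤ β
          γ≤β = inj₁ γ<β
          α≤β : α ≤ β
          α≤β = ≤-trans α≤1 1≤β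
          x₂-coefficient : (1# - α) * (γ - 1#) * (α - β) ≤ 0#
          x₂-coefficient = *-nonneg-nonpos (*-nonneg (x≤y⇒0≤y-x α≤1) (x≤y⇒0≤y-x 1≤γ)) (x≤y⇒x-y≤0 α≤β)
          T-coefficient : β * (1# - α) * (1# - γ) ≤ 0#
          T-coefficient = *-nonneg-nonpos (*-nonneg 0≤β (x≤y⇒0≤y-x α≤1)) (x≤y⇒x-y≤0 1≤γ)
          1⇝0 : Walk 1F 0F
          1⇝0 = ρ₁≤ρ₄ 1≤γ ◅ ρ₄≤ρ₃ 1≤γ ◅ ρ₃≤ρ₀ γ≤β α≤β ◅ ε
          into-1 : gap 1F 0F ≤ 0# ⊎ gap 1F 2F ≤ 0# ⊎ gap 1F 3F ≤ 0# → ∀ x y → ρ x ≡ ρ y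
          into-1 (inj₁ gap₁₀≤0) =
            closed-walk-constant (1⇝0 ◅◅ ρ₀≤ρ₂ α≤1 ◅ ρ₂≤ρ₄ α≤1 ◅ ρ₄≤ρ₃ 1≤γ ◅ ρ₃≤ρ₀ γ≤β α≤β ◅ gap≤0⇒ρ≥ gap₁₀≤0 ◅ ε)
          into-1 (inj₂ (inj₁ gap₁₂≤0)) = closed-walk-constant (1⇝0 ◅◅ ρ₀≤ρ₂ α≤1 ◅ gap≤0⇒ρ≥ gap₁₂≤0 ◅ ε)
          into-1 (inj₂ (inj₂ gap₁₃≤0)) = closed-walk-constant (1⇝0 ◅◅ ρ₀≤ρ₂ α≤1 ◅ ρ₂≤ρ₄ α≤1 ◅ ρ₄≤ρ₃ 1≤γ ◅ gap≤0⇒ρ≥ gap₁₃≤0 ◅ ε)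

        constant-if-α≤1 : α ≤ 1# → ∀ x y → ρ x ≡ ρ y
        constant-if-α≤1 α≤1 with open-trisection 1# β γ
        ... | inj₁ γ≤1 = cycle-α≤1-γ≤1 α≤1 γ≤1
        ... | inj₂ (inj₂ β≤γ) = cycle-α≤1-β≤γ α≤1 β≤γ
        ... | inj₂ (inj₁ (1<γ , γ<β)) =
          [ (λ α<1 → walk-α<1<γ<β α<1 1<γ γ<β)
          , (λ α≡1 → cycle-1≤α≤β-1≤γ≤β (inj₂ (sym α≡1)) (≤-trans α≤1 1≤β) (inj₁ 1<γ) (inj₁ γ<β)) ]′ α≤1

        constant : ¬ Exceptional → ∀ x y → ρ x ≡ ρ y
        constant ¬exceptional with <-cmp α 1#
        ... | tri< α<1 _ _ = constant-if-α≤1 (inj₁ α<1)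
        ... | tri≈ _ α≡1 _ = constant-if-α≤1 (inj₂ α≡1)
        ... | tri> _ _ 1<α with <-cmp α β | closed-trisection 1# β γ | open-trisection 1# β γ
        ...   | tri< α<β _ _ | inj₁ γ<1 | _ = contradiction (inj₂ (γ<1 , 1<α , α<β)) ¬exceptional
        ...   | tri< α<β _ _ | inj₂ (inj₁ (1≤γ , γ≤β)) | _ = cycle-1≤α≤β-1≤γ≤β (inj₁ 1<α) (inj₁ α<β) 1≤γ γ≤β
        ...   | tri< α<β _ _ | inj₂ (inj₂ β<γ) | _ = walk-1<α<β<γ 1<α α<β β<γ
        ...   | tri≈ _ α≡β _ | _ | inj₁ γ≤1 = cycle-β≤α-γ≤1 (inj₂ (sym α≡β)) γ≤1
        ...   | tri≈ _ α≡β _ | _ | inj₂ (inj₁ (1<γ , γ<β)) = cycle-1≤α≤β-1≤γ≤β (inj₁ 1<α) (inj₂ α≡β) (inj₁ 1<γ) (inj₁ γ<β)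
        ...   | tri≈ _ α≡β _ | _ | inj₂ (inj₂ β≤γ) = cycle-β≤α-β≤γ (inj₂ (sym α≡β)) β≤γ
        ...   | tri> _ _ β<α | _ | inj₁ γ≤1 = cycle-β≤α-γ≤1 (inj₁ β<α) γ≤1
        ...   | tri> _ _ β<α | _ | inj₂ (inj₁ (1<γ , γ<β)) = contradiction (inj₁ (1<γ , γ<β , β<α)) ¬exceptional
        ...   | tri> _ _ β<α | _ | inj₂ (inj₂ β≤γ) = cycle-β≤α-β≤γ (inj₁ β<α) β≤γ

    B-diagonal : ∀ i → B i i ≡ 1#
    B-diagonal 0F = refl
    B-diagonal 1F = refl
    B-diagonal 2F = refl
    B-diagonal 3F = refl
    B-diagonal 4F = refl

    module Sink₃Syntax = SinkWitnesses.Sink₃ (expressions 3) renaming (row to row′)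
    module Sink₂Syntax = SinkWitnesses.Sink₂ (expressions 3) renaming (row to row′)

    module SinkAt₃ (0<α : 0# < α) (1≤β : 1# ≤ β) (1<γ : 1# < γ) (γ<β : γ < β) (β<α : β < α) where
      open SinkWitnesses (CommutativeRing.rawRing commutativeRing) α β γ using (two; three; module Sink₃)
      open SinkWitnesses (CommutativeRing.rawRing commutativeRing) α β γ public using (X₀³; X₁³; x₂³)
      open Sink₃ using (row)

      0<α-β : 0# < α - β
      0<α-β = x<y⇒0<y-x β<α
      0<β-γ : 0# < β - γ
      0<β-γ = x<y⇒0<y-x γ<β
      0<γ-1 : 0# < γ - 1#
      0<γ-1 = x<y⇒0<y-x 1<γ
      0<α-1 : 0# < α - 1#
      0<α-1 = x<y⇒0<y-x (<-trans _ _ _ 1<γ (<-trans _ _ _ γ<β β<α))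

      0<X₀³ : 0# < X₀³
      0<X₀³ = *-pos _ _ 0<three 0<γ-1
      0≤X₁³ : 0# ≤ X₁³
      0≤X₁³ = inj₁ (*-pos _ _ 0<α-β (<-trans _ _ _ 0<α (x<x+y 0<two)))
      0≤x₂³ : 0# ≤ x₂³
      0≤x₂³ = inj₁ (*-pos _ _ 0<β-γ (+-pos-nonneg (*-pos _ _ 0<two 0<α) (inj₁ 0<1)))

      sink : ∀ i → i ≢ 3F → B i 3F * row 3F < row i
      sink 0F _ = 0<y-x⇒x<y (subst (0# <_) (sym identity) (*-pos _ _ (*-pos _ _ 0<α-β 0<β-γ) 0<α-1))
        where
        identity : row 0F - β * row 3F ≡ (α - β) * (β - γ) * (α - 1#)
        identity = solve 3 (λ α β γ → let open Sink₃Syntax α β γ in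
          row′ 0F :- β :* row′ 3F := (α :- β) :* (β :- γ) :* (α :- :1)) refl α β γ
      sink 1F _ = 0<y-x⇒x<y (subst (0# <_) (sym identity) (*-pos _ _ (*-pos _ _ 0<β-γ 0<γ-1) 0<α-1))
        where
        identity : row 1F - γ * row 3F ≡ (β - γ) * (γ - 1#) * (α - 1#)
        identity = solve 3 (λ α β γ → let open Sink₃Syntax α β γ in
          row′ 1F :- γ :* row′ 3F := (β :- γ) :* (γ :- :1) :* (α :- :1)) refl α β γ
      sink 2F _ = 0<y-x⇒x<y (subst (0# <_) (sym identity) (*-pos _ _ (*-pos _ _ 0<α-β 0<γ-1) 0<α-1))
        where
        identity : row 2F - 1# * row 3F ≡ (α - β) * (γ - 1#) * (α - 1#)
        identity = solve 3 (λ α β γ → let open Sink₃Syntax α β γ in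
          row′ 2F :- :1 :* row′ 3F := (α :- β) :* (γ :- :1) :* (α :- :1)) refl α β γ
      sink 3F 3≢3 = contradiction refl 3≢3
      sink 4F _ = 0<y-x⇒x<y (subst (0# <_) (sym identity) (*-pos _ _ 0<γ-1
        (+-pos-nonneg (*-pos _ _ 0<α-β (<-trans _ _ _ 0<α (x<x+y 0<two))) (*-nonneg (*-nonneg (inj₁ 0<α) (x≤y⇒0≤y-x 1≤β)) (inj₁ 0<three)))))
        where
        identity : row 4F - 1# * row 3F ≡ (γ - 1#) * ((α - β) * (α + two) + α * (β - 1#) * three)
        identity = solve 3 (λ α β γ → let open Sink₃Syntax α β γ in
          row′ 4F :- :1 :* row′ 3F := (γ :- :1) :* ((α :- β) :* (α :+ (:1 :+ :1)) :+ α :* (β :- :1) :* (:1 :+ :1 :+ :1))) refl α β γ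

    module SinkAt₂ (0<γ : 0# < γ) (γ<1 : γ < 1#) (1<α : 1# < α) (α<β : α < β) where
      open SinkWitnesses (CommutativeRing.rawRing commutativeRing) α β γ using (two; three; module Sink₂)
      open SinkWitnesses (CommutativeRing.rawRing commutativeRing) α β γ public using (X₀²; X₁²; x₃²)
      open Sink₂ using (row)

      0<β-α : 0# < β - α
      0<β-α = x<y⇒0<y-x α<β
      0<β-γ : 0# < β - γ
      0<β-γ = x<y⇒0<y-x (<-trans _ _ _ γ<1 (<-trans _ _ _ 1<α α<β))
      0<1-γ : 0# < 1# - γ
      0<1-γ = x<y⇒0<y-x γ<1
      0<α-1 : 0# < α - 1#
      0<α-1 = x<y⇒0<y-x 1<α
      0<β : 0# < β
      0<β = <-trans _ _ _ 0<1 (<-trans _ _ _ 1<α α<β)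

      0<X₀² : 0# < X₀²
      0<X₀² = *-pos _ _ (*-pos _ _ 0<three 0<γ) 0<1-γ
      0≤X₁² : 0# ≤ X₁²
      0≤X₁² = inj₁ (*-pos _ _ 0<β-α (+-pos-nonneg (*-pos _ _ 0<two 0<γ) (inj₁ 0<β)))
      0≤x₃² : 0# ≤ x₃²
      0≤x₃² = inj₁ (*-pos _ _ (*-pos _ _ 0<γ 0<α-1) (+-pos-nonneg 0<γ (inj₁ (*-pos _ _ 0<two 0<β))))

      sink : ∀ i → i ≢ 2F → B i 2F * row 2F < row i
      sink 0F _ = 0<y-x⇒x<y (subst (0# <_) (sym identity) (*-pos _ _ (*-pos _ _ (*-pos _ _ 0<γ 0<α-1) 0<β-α) 0<β-γ))
        where
        identity : row 0F - α * row 2F ≡ γ * (α - 1#) * (β - α) * (β - γ)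
        identity = solve 3 (λ α β γ → let open Sink₂Syntax α β γ in
          row′ 0F :- α :* row′ 2F := γ :* (α :- :1) :* (β :- α) :* (β :- γ)) refl α β γ
      sink 1F _ = 0<y-x⇒x<y (subst (0# <_) (sym identity) (*-pos _ _ (*-pos _ _ (*-pos _ _ 0<γ 0<α-1) 0<1-γ) 0<β-γ))
        where
        identity : row 1F - 1# * row 2F ≡ γ * (α - 1#) * (1# - γ) * (β - γ)
        identity = solve 3 (λ α β γ → let open Sink₂Syntax α β γ in
          row′ 1F :- :1 :* row′ 2F := γ :* (α :- :1) :* (:1 :- γ) :* (β :- γ)) refl α β γ
      sink 2F 2≢2 = contradiction refl 2≢2
      sink 3F _ = 0<y-x⇒x<y (subst (0# <_) (sym identity) (*-pos _ _ (*-pos _ _ 0<1-γ 0<β-α) 0<β-γ))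
        where
        identity : row 3F - 1# * row 2F ≡ (1# - γ) * (β - α) * (β - γ)
        identity = solve 3 (λ α β γ → let open Sink₂Syntax α β γ in
          row′ 3F :- :1 :* row′ 2F := (:1 :- γ) :* (β :- α) :* (β :- γ)) refl α β γ
      sink 4F _ = 0<y-x⇒x<y (subst (0# <_) (sym identity)
        (*-pos _ _ (*-pos _ _ (*-pos _ _ (*-pos _ _ 0<three 0<β) 0<γ) 0<α-1) 0<1-γ))
        where
        identity : row 4F - 1# * row 2F ≡ three * β * γ * (α - 1#) * (1# - γ)
        identity = solve 3 (λ α β γ → let open Sink₂Syntax α β γ in
          row′ 4F :- :1 :* row′ 2F := (:1 :+ :1 :+ :1) :* β :* γ :* (α :- :1) :* (:1 :- γ)) refl α β γ

  module BlockMatrix (m : ℕ) (α β γ : Carrier) where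
    open Block α β γ

    A : Matrix (5 ℕ.+ m)
    A = blockA (5 ℕ.+ m) α β γ

    vertex : Fin 5 → Fin (5 ℕ.+ m)
    vertex i = i Fin.↑ˡ m

    beyond : Fin (suc m) → Fin (5 ℕ.+ m)
    beyond l = 4 Fin.↑ʳ l

    class : Fin (5 ℕ.+ m) → Fin 5
    class 0F = 0F
    class 1F = 1F
    class 2F = 2F
    class 3F = 3F
    class (Fin.suc (Fin.suc (Fin.suc (Fin.suc _)))) = 4F

    class-vertex : ∀ i → class (vertex i) ≡ i
    class-vertex 0F = refl
    class-vertex 1F = refl
    class-vertex 2F = refl
    class-vertex 3F = refl
    class-vertex 4F = refl

    vertex-class : ∀ {k t} → class k ≡ t → t ≢ 4F → k ≡ vertex t
    vertex-class {0F} refl _ = refl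
    vertex-class {1F} refl _ = refl
    vertex-class {2F} refl _ = refl
    vertex-class {3F} refl _ = refl
    vertex-class {Fin.suc (Fin.suc (Fin.suc (Fin.suc _)))} refl 4≢4 = contradiction refl 4≢4

    A-vertex : ∀ i j → A (vertex i) (vertex j) ≡ B i j
    A-vertex i j = cong₂ (entryB α β γ) (toℕ-↑ˡ i m) (toℕ-↑ˡ j m)

    A-class : ∀ k j → A k j ≡ A (vertex (class k)) j
    A-class 0F j = refl
    A-class 1F j = refl
    A-class 2F j = refl
    A-class 3F j = refl
    A-class (Fin.suc (Fin.suc (Fin.suc (Fin.suc _)))) j = refl

    module ConeVector {X₀ X₁ T : Carrier} (0<α : 0# < α) (0<β : 0# < β) (0<γ : 0# < γ) (c : Vector (5 ℕ.+ m))
                      (c₀≡ : c 0F ≡ α * β * X₀) (c₁≡ : c 1F ≡ γ * X₁) (tail≡ : sumF (suc m) (λ l → c (beyond l) * 1#) ≡ T) where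
      open Gaps X₀ X₁ (c 2F) (c 3F) T using (a₀; a₁; b₂; b₃; row)

      w : Vector (5 ℕ.+ m)
      w k = sumF (5 ℕ.+ m) (λ j → c j * A k j)

      column₀ : ∀ i → c 0F * A (vertex i) 0F ≡ X₀ * a₀ i
      column₀ i = trans (cong (_* A (vertex i) 0F) c₀≡) (scaled i)
        where
        scaled : ∀ i → α * β * X₀ * A (vertex i) 0F ≡ X₀ * a₀ i
        scaled 0F = solve 3 (λ α β X → α :* β :* X :* :1 := X :* (α :* β)) refl α β X₀
        scaled 1F = solve 3 (λ α β X → α :* β :* X :* :1 := X :* (α :* β)) refl α β X₀
        scaled 2F = trans (solve 4 (λ α β X α′ → α :* β :* X :* (:1 :* α′) := X :* β :* α :* α′) refl α β X₀ (α ⁻¹)) (x*y*y⁻¹≡x 0<α (X₀ * β))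
        scaled 3F = trans (solve 4 (λ α β X β′ → α :* β :* X :* (:1 :* β′) := X :* α :* β :* β′) refl α β X₀ (β ⁻¹)) (x*y*y⁻¹≡x 0<β (X₀ * α))
        scaled 4F = solve 3 (λ α β X → α :* β :* X :* :1 := X :* (α :* β)) refl α β X₀

      column₁ : ∀ i → c 1F * A (vertex i) 1F ≡ X₁ * a₁ i
      column₁ i = trans (cong (_* A (vertex i) 1F) c₁≡) (scaled i)
        where
        scaled : ∀ i → γ * X₁ * A (vertex i) 1F ≡ X₁ * a₁ i
        scaled 0F = solve 2 (λ γ X → γ :* X :* :1 := X :* γ) refl γ X₁
        scaled 1F = solve 2 (λ γ X → γ :* X :* :1 := X :* γ) refl γ X₁
        scaled 2F = solve 2 (λ γ X → γ :* X :* :1 := X :* γ) refl γ X₁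
        scaled 3F = trans (solve 3 (λ γ X γ′ → γ :* X :* (:1 :* γ′) := X :* :1 :* γ :* γ′) refl γ X₁ (γ ⁻¹)) (x*y*y⁻¹≡x 0<γ (X₁ * 1#))
        scaled 4F = solve 2 (λ γ X → γ :* X :* :1 := X :* γ) refl γ X₁

      column₂ : ∀ i → A (vertex i) 2F ≡ b₂ i
      column₂ 0F = refl
      column₂ 1F = refl
      column₂ 2F = refl
      column₂ 3F = refl
      column₂ 4F = refl

      column₃ : ∀ i → A (vertex i) 3F ≡ b₃ i
      column₃ 0F = refl
      column₃ 1F = refl
      column₃ 2F = refl
      column₃ 3F = refl
      column₃ 4F = refl

      column-beyond : ∀ i l → A (vertex i) (beyond l) ≡ 1#
      column-beyond 0F l = refl
      column-beyond 1F l = refl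
      column-beyond 2F l = refl
      column-beyond 3F l = refl
      column-beyond 4F l = refl

      w-vertex : ∀ i → w (vertex i) ≡ row i
      w-vertex i = begin
        c 0F * A (vertex i) 0F + (c 1F * A (vertex i) 1F + (c 2F * A (vertex i) 2F + (c 3F * A (vertex i) 3F + tail)))
          ≡⟨ cong₂ _+_ (column₀ i) (cong₂ _+_ (column₁ i) (cong₂ _+_ (cong (c 2F *_) (column₂ i))
               (cong₂ _+_ (cong (c 3F *_) (column₃ i)) (trans (sumF-cong (suc m) (λ l → cong (c (beyond l) *_) (column-beyond i l))) tail≡)))) ⟩
        X₀ * a₀ i + (X₁ * a₁ i + (c 2F * b₂ i + (c 3F * b₃ i + T)))
          ≡⟨ solve 5 (λ a b c d e → a :+ (b :+ (c :+ (d :+ e))) := a :+ b :+ c :+ d :+ e) refl _ _ _ _ T ⟩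
        row i ∎
        where
        tail : Carrier
        tail = sumF (suc m) (λ l → c (beyond l) * A (vertex i) (beyond l))

      w-class : ∀ k → w k ≡ row (class k)
      w-class k = trans (sumF-cong (5 ℕ.+ m) (λ j → cong (c j *_) (A-class k j))) (w-vertex (class k))

    module Dominating {w c : Vector (5 ℕ.+ m)} (0<α : 0# < α) (0<γ : 0# < γ) (1≤β : 1# ≤ β)
                      (c≥0 : ∀ j → 0# ≤ c j) (w≡Ac : ∀ i → w i ≡ sumF (5 ℕ.+ m) (λ j → c j * A i j))
                      (w>0 : Positive w) {v : Vector (5 ℕ.+ m)} (v>0 : Positive v) (v≽w : Dominates A v w) where
      0<β : 0# < β
      0<β = <-≤-trans 0<1 1≤β

      X₀ X₁ T : Carrier
      X₀ = c 0F * (α ⁻¹ * β ⁻¹)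
      X₁ = c 1F * γ ⁻¹
      T = sumF (suc m) (λ l → c (beyond l) * 1#)

      c₀≡ : c 0F ≡ α * β * X₀
      c₀≡ = sym (begin
        α * β * (c 0F * (α ⁻¹ * β ⁻¹))
          ≡⟨ solve 5 (λ α β c α′ β′ → α :* β :* (c :* (α′ :* β′)) := c :* (α :* α′) :* (β :* β′)) refl α β (c 0F) (α ⁻¹) (β ⁻¹) ⟩
        c 0F * (α * α ⁻¹) * (β * β ⁻¹)   ≡⟨ cong₂ (λ a b → c 0F * a * b) (x*x⁻¹≡1 0<α) (x*x⁻¹≡1 0<β) ⟩
        c 0F * 1# * 1#                   ≡⟨ trans (*-identityʳ _) (*-identityʳ _) ⟩
        c 0F                             ∎)

      c₁≡ : c 1F ≡ γ * X₁
      c₁≡ = sym (begin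
        γ * (c 1F * γ ⁻¹)   ≡⟨ solve 3 (λ γ c γ′ → γ :* (c :* γ′) := c :* (γ :* γ′)) refl γ (c 1F) (γ ⁻¹) ⟩
        c 1F * (γ * γ ⁻¹)   ≡⟨ trans (cong (c 1F *_) (x*x⁻¹≡1 0<γ)) (*-identityʳ _) ⟩
        c 1F                ∎)

      open ConeVector 0<α 0<β 0<γ c c₀≡ c₁≡ refl using (w-vertex; w-class)
      open Gaps X₀ X₁ (c 2F) (c 3F) T using (row; module Connected)
      open Dominated v>0 w>0 v≽w

      row-vertex : ∀ i → w (vertex i) ≡ row i
      row-vertex i = trans (w≡Ac _) (w-vertex i)

      row-class : ∀ k → w k ≡ row (class k)
      row-class k = trans (w≡Ac k) (w-class k)

      ρ : Fin 5 → Carrier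
      ρ i = v (vertex i) / w (vertex i)

      ρ-mono : ∀ {i j} → B i j * row j ≤ row i → ρ i ≤ ρ j
      ρ-mono {i} {j} = ratio-mono ∘ subst₂ _≤_ (sym (cong₂ _*_ (A-vertex i j) (row-vertex j))) (sym (row-vertex i))

      ρ-antitone : ∀ {i j} → row i ≤ B i j * row j → ρ j ≤ ρ i
      ρ-antitone {i} {j} = ratio-antitone ∘ subst₂ _≤_ (sym (row-vertex i)) (sym (cong₂ _*_ (A-vertex i j) (row-vertex j)))

      open Connected 0<α 0<γ 1≤β
        (*-nonneg (c≥0 0F) (inj₁ (*-pos _ _ (⁻¹-pos 0<α) (⁻¹-pos 0<β)))) (*-nonneg (c≥0 1F) (inj₁ (⁻¹-pos 0<γ)))
        (c≥0 2F) (c≥0 3F) (sumF-nonneg (suc m) (λ l → *-nonneg (c≥0 (beyond l)) (inj₁ 0<1))) ρ ρ-mono ρ-antitone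
        using (constant)

      same-row : ∀ k → A k (vertex (class k)) * w (vertex (class k)) ≡ w k
      same-row k = begin
        A k (vertex (class k)) * w (vertex (class k))
          ≡⟨ cong₂ _*_ (trans (A-class k _) (trans (A-vertex (class k) (class k)) (B-diagonal (class k)))) (row-vertex (class k)) ⟩
        1# * row (class k)
          ≡⟨ trans (*-identityˡ _) (sym (row-class k)) ⟩
        w k ∎

      ratio-class : ∀ k → v k / w k ≡ ρ (class k)
      ratio-class k = ≤-antisym (ratio-mono (inj₂ (same-row k))) (ratio-antitone (inj₂ (sym (same-row k))))

      proportional-to-w : ¬ Exceptional → ∀ k → v k ≡ ρ 0F * w k
      proportional-to-w ¬exceptional = proportional (λ k → trans (ratio-class k) (constant ¬exceptional (class k) 0F))

    coneInEfficient : Reciprocal A → 0# < α → 0# < γ → 1# ≤ β → ¬ Exceptional → ConeInEfficient A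
    coneInEfficient (A>0 , _) 0<α 0<γ 1≤β ¬exceptional w w∈cone@(c , c≥0 , _ , w≡Ac) = w>0 , λ v v>0 v≽w →
      let open Dominating 0<α 0<γ 1≤β c≥0 w≡Ac w>0 v>0 v≽w
      in ρ 0F , *-pos _ _ (v>0 _) (⁻¹-pos (w>0 _)) , proportional-to-w ¬exceptional
      where
      w>0 : Positive w
      w>0 = inCone-positive A>0 w∈cone

    sink-obstruction : Reciprocal A → 0# < α → 0# < β → 0# < γ → ∀ X₀ X₁ x₂ x₃ → 0# < X₀ → 0# ≤ X₁ → 0# ≤ x₂ → 0# ≤ x₃ →
                       ∀ t → t ≢ 4F → (let open Gaps X₀ X₁ x₂ x₃ 0# in ∀ i → i ≢ t → B i t * row t < row i) →
                       ¬ ConeInEfficient A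
    sink-obstruction A-reciprocal 0<α 0<β 0<γ X₀ X₁ x₂ x₃ 0<X₀ 0≤X₁ 0≤x₂ 0≤x₃ t t≢4 sink cone⊆efficient =
      sink-inefficient A-reciprocal (proj₁ efficient) sink′ {vertex 4F}
        (λ 4≡t → t≢4 (trans (sym (class-vertex t)) (cong class (sym 4≡t)))) efficient
      where
      c : Vector (5 ℕ.+ m)
      c 0F = α * β * X₀
      c 1F = γ * X₁
      c 2F = x₂
      c 3F = x₃
      c (Fin.suc (Fin.suc (Fin.suc (Fin.suc _)))) = 0#
      c≥0 : ∀ j → 0# ≤ c j
      c≥0 0F = inj₁ (*-pos _ _ (*-pos _ _ 0<α 0<β) 0<X₀)
      c≥0 1F = *-nonneg (inj₁ 0<γ) 0≤X₁
      c≥0 2F = 0≤x₂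
      c≥0 3F = 0≤x₃
      c≥0 (Fin.suc (Fin.suc (Fin.suc (Fin.suc _)))) = ≤-refl
      open ConeVector 0<α 0<β 0<γ c refl refl (sumF-zero (suc m) (λ _ → zeroˡ 1#)) using (w; w-vertex; w-class)
      efficient : Efficient A w
      efficient = cone⊆efficient w (c , c≥0 , (0F , >0⇒≢0 (*-pos _ _ (*-pos _ _ 0<α 0<β) 0<X₀)) , λ _ → refl)
      sink′ : ∀ k → k ≢ vertex t → A k (vertex t) * w (vertex t) < w k
      sink′ k k≢t = subst₂ _<_ (sym (cong₂ _*_ (trans (A-class k _) (A-vertex (class k) t)) (w-vertex t))) (sym (w-class k))
                             (sink (class k) (λ class≡t → k≢t (vertex-class class≡t t≢4)))

    not-coneInEfficient : Reciprocal A → 0# < α → 0# < γ → 1# ≤ β → Exceptional → ¬ ConeInEfficient A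
    not-coneInEfficient A-reciprocal 0<α 0<γ 1≤β (inj₁ (1<γ , γ<β , β<α)) =
      sink-obstruction A-reciprocal 0<α (<-≤-trans 0<1 1≤β) 0<γ X₀³ X₁³ x₂³ 0# 0<X₀³ 0≤X₁³ 0≤x₂³ ≤-refl 3F (λ ()) sink
      where open SinkAt₃ 0<α 1≤β 1<γ γ<β β<α
    not-coneInEfficient A-reciprocal 0<α 0<γ 1≤β (inj₂ (γ<1 , 1<α , α<β)) =
      sink-obstruction A-reciprocal 0<α (<-≤-trans 0<1 1≤β) 0<γ X₀² X₁² 0# x₃² 0<X₀² 0≤X₁² ≤-refl 0≤x₃² 2F (λ ()) sink
      where open SinkAt₂ 0<γ γ<1 1<α α<β

    coneInEfficient⇔¬exceptional : Reciprocal A → 0# < α → 0# < γ → 1# ≤ β → ConeInEfficient A ⇔ (¬ Exceptional)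
    coneInEfficient⇔¬exceptional A-reciprocal 0<α 0<γ 1≤β =
      mk⇔ (λ cone⊆efficient exceptional → not-coneInEfficient A-reciprocal 0<α 0<γ 1≤β exceptional cone⊆efficient)
          (coneInEfficient A-reciprocal 0<α 0<γ 1≤β)

open import Data.Nat using (_≤_; s≤s; z≤n)

mainTheorem13 : (ℝ : RealField) → let open RealField ℝ hiding (_≤_) in let open Theory ℝ in
    (n : ℕ) → 5 ≤ n → (R : Matrix n) → Reciprocal R →
    (a13 a14 a24 : Carrier) → 0# < a13 → 0# < a24 → RealField._≤_ ℝ 1# a14 →
    MonomiallySimilar (blockA n a13 a14 a24) R →
    (ConeInEfficient R ⇔
      (¬ ((1# < a24 × a24 < a14 × a14 < a13) ⊎ (a24 < 1# × 1# < a13 × a13 < a14))))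
mainTheorem13 ℝ _ (s≤s (s≤s (s≤s (s≤s (s≤s {n = m} z≤n))))) R R-reciprocal α β γ 0<α 0<γ 1≤β A∼R =
  coneInEfficient⇔¬exceptional (Similarity.reciprocal A∼R R-reciprocal) 0<α 0<γ 1≤β ⇔-∘ coneInEfficient-similar A∼R
  where
  open Proof ℝ
  open BlockMatrix m α β γ
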